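{- If $D\in D(1,1)$ has $m$ edges, then $D$ contains a directed cut of size at least $m/3$. Moreover, $D$ has no directed cut of size larger than $m/3$ if and only if $D$ is the union of pairwise vertex-disjoint directed triangles.
   Context: All digraphs are finite, without loops and without parallel edges. For integers $k,\ell\ge 0$, $D(k,\ell)$ denotes the family of digraphs in which every vertex $v$ satisfies $d^-(v)\le k$ or $d^+(v)\le \ell$. A directed cut of a digraph $D$ is a set of edges of the form $\{xy\in E(D): x\in X, y\in Y\}$ for some partition $X,Y$ of $V(D)$; its size is its cardinality. A directed triangle is a directed cycle of length 3. -}

module Defs where

open import Data.Nat using (ℕ; _+_; _≤_)
open import Data.Bool using (Bool; true; false; not; _∧_; if_then_else_)
open import Data.Fin using (Fin)
open import Data.Nat.ListAction using (sum)
open import Data.List using (List; map; allFin; []; _∷_; _++_)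
open import Data.List.Membership.Propositional using (_∈_)
open import Data.List.Relation.Unary.Unique.Propositional using (Unique)
open import Data.Product using (_×_; Σ; ∃; ∃-syntax; _,_)
open import Data.Sum using (_⊎_)
open import Relation.Binary.PropositionalEquality using (_≡_; _≢_)
open import Function using (_⇔_)

-- The edge relation is
-- a Boolean-valued relation, so there are no parallel edges; loops are
-- excluded explicitly.  (Opposite edges xy and yx may both be present.)
record Digraph : Set where
  field
    n        : ℕ
    E        : Fin n → Fin n → Bool
    loopless : ∀ v → E v v ≡ false
open Digraph public

Σᵥ : ∀ {k} → (Fin k → ℕ) → ℕ
Σᵥ {k} f = sum (map f (allFin k))

b2n : Bool → ℕ
b2n true  = 1
b2n false = 0

edges : Digraph → ℕ
edges D = Σᵥ λ x → Σᵥ λ y → b2n (E D x y)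

indeg : (D : Digraph) → Fin (n D) → ℕ
indeg D v = Σᵥ λ x → b2n (E D x v)

outdeg : (D : Digraph) → Fin (n D) → ℕ
outdeg D v = Σᵥ λ y → b2n (E D v y)

InD : ℕ → ℕ → Digraph → Set
InD k ℓ D = ∀ v → indeg D v ≤ k ⊎ outdeg D v ≤ ℓ

-- A partition (X , Y) of V(D) is given by the characteristic function of X;
-- Y is its complement.  Size of the directed cut {xy ∈ E : x ∈ X, y ∈ Y}.
cutSize : (D : Digraph) → (Fin (n D) → Bool) → ℕ
cutSize D X = Σᵥ λ x → Σᵥ λ y → b2n (X x ∧ not (X y) ∧ E D x y)

triEdges : ∀ {k} → Fin k × Fin k × Fin k → List (Fin k × Fin k)
triEdges (a , b , c) = (a , b) ∷ (b , c) ∷ (c , a) ∷ []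

triVerts : ∀ {k} → Fin k × Fin k × Fin k → List (Fin k)
triVerts (a , b , c) = a ∷ b ∷ c ∷ []

concatMap' : ∀ {A B : Set} → (A → List B) → List A → List B
concatMap' f []       = []
concatMap' f (x ∷ xs) = f x ++ concatMap' f xs

-- D is the union of pairwise vertex-disjoint directed triangles: there is a
-- list of triangles (a,b,c) whose vertices (over all triangles) are pairwise
-- distinct (so each triangle has 3 distinct vertices and different triangles
-- are vertex-disjoint), and the edge set of D is exactly the union of the
-- triangles' edge sets.
UnionOfDisjointTriangles : Digraph → Set
UnionOfDisjointTriangles D =
  ∃[ ts ] ( Unique (concatMap' triVerts ts)
          × (∀ x y → (E D x y ≡ true ⇔ (x , y) ∈ concatMap' triEdges ts)) )

module Submission where

-- Type each vertex A (d⁻ ≤ 1) or B (d⁺ ≤ 1) and, for colours c : V → Fin 3,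
-- let part i hold the A-vertices of colour ≠ i and the B-vertices of colour i.
-- Every edge lies in one of the three cuts once the colouring respects the
-- graph of a fixpoint-free partial function; such graphs are 2-degenerate,
-- hence 3-colourable, and averaging the three cuts gives m/3.  If no cut
-- exceeds m/3, two refinements (EdgeOffTriangle, HeavyVertex) must fail; a
-- double count of "bad" edges (NoSurplus) then makes all degrees one with every
-- edge on a triangle, and D splits into triangles (TriangleDecomposition).
-- Conversely a cut meets each triangle in at most one edge (small-cuts).

open import Defs
open import Data.Nat using (ℕ; zero; suc; _+_; _*_; _≤_; _<_; z≤n; s≤s)
open import Data.Nat.Properties
open import Data.Nat.ListAction using (sum)
open import Data.Bool using (Bool; true; false; not; _∧_; _∨_; if_then_else_)
open import Data.Bool.Properties
  using (∧-conicalˡ; ∧-conicalʳ; ∧-zeroʳ; ∧-identityʳ; ∧-comm; ∧-assoc; ∨-zeroʳ; not-injective; ¬-not)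
  renaming (_≟_ to _≟ᵇ_)
open import Data.Fin using (Fin; zero; suc) renaming (_<_ to _<ᶠ_)
open import Data.Fin.Properties as Fin using (any?)
open import Data.Maybe using (Maybe; just; nothing)
open import Data.Maybe.Properties using (just-injective)
import Data.List as List
open import Data.List using (List; []; _∷_; _++_; allFin)
open import Data.List.Properties using (map-tabulate; ++-assoc)
open import Data.List.Membership.Propositional using (_∈_)
open import Data.List.Membership.Propositional.Properties using (∈-++⁺ˡ; ∈-++⁺ʳ; ∈-++⁻; ∈-allFin)
open import Data.List.Relation.Unary.Any using (here; there)
open import Data.List.Relation.Unary.All using ([]; _∷_; lookup)
open import Data.List.Relation.Unary.AllPairs using ([]; _∷_)
open import Data.List.Relation.Unary.Unique.Propositional using (Unique)
import Data.List.Relation.Unary.Unique.Propositional.Properties as Unique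
open import Data.Product using (_×_; Σ; ∃-syntax; _,_; proj₁; proj₂)
open import Data.Sum using (_⊎_; inj₁; inj₂)
open import Data.Empty using (⊥; ⊥-elim)
open import Relation.Nullary using (¬_; Dec; yes; no; does; contradiction)
open import Relation.Nullary.Decidable using (dec-true; dec-false; _×-dec_)
open import Relation.Binary using (tri<; tri≈; tri>)
open import Relation.Binary.PropositionalEquality
open import Function using (_∘_; id; const; _⇔_; mk⇔; Equivalence)
open import Data.Vec.Functional using (updateAt)
open import Data.Vec.Functional.Properties using (updateAt-updates; updateAt-minimal)
open import Algebra.Properties.Semiring.Sum +-*-semiring
  using (sum-cong-≗; ∑-distrib-+; ∑-comm; sum-replicate-zero; *-distribˡ-sum)
  renaming (sum to ∑)

sum-tabulate : ∀ {k} (f : Fin k → ℕ) → sum (List.tabulate f) ≡ ∑ f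
sum-tabulate {zero}  f = refl
sum-tabulate {suc k} f = cong (f zero +_) (sum-tabulate (f ∘ suc))

Σᵥ≡∑ : ∀ {k} (f : Fin k → ℕ) → Σᵥ f ≡ ∑ f
Σᵥ≡∑ f = trans (cong sum (map-tabulate id f)) (sum-tabulate f)

∑-zero : ∀ {k} {f : Fin k → ℕ} → (∀ i → f i ≡ 0) → ∑ f ≡ 0
∑-zero {k} f≡0 = trans (sum-cong-≗ f≡0) (sum-replicate-zero k)

∑-const : ∀ k c → ∑ {k} (λ _ → c) ≡ k * c
∑-const zero    c = refl
∑-const (suc k) c = cong (c +_) (∑-const k c)

∑-mono : ∀ {k} {f g : Fin k → ℕ} → (∀ i → f i ≤ g i) → ∑ f ≤ ∑ g
∑-mono {zero}  f≤g = z≤n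
∑-mono {suc k} f≤g = +-mono-≤ (f≤g zero) (∑-mono (f≤g ∘ suc))

∑∑-+ : ∀ {k} (f g : Fin k → Fin k → ℕ) →
       ∑ (λ x → ∑ (λ y → f x y + g x y)) ≡ ∑ (λ x → ∑ (f x)) + ∑ (λ x → ∑ (g x))
∑∑-+ f g = trans (sum-cong-≗ λ x → ∑-distrib-+ (f x) (g x)) (∑-distrib-+ (λ x → ∑ (f x)) (λ x → ∑ (g x)))

∑-mono-< : ∀ {k} {f g : Fin k → ℕ} → (∀ i → f i ≤ g i) → ∀ a → f a < g a → ∑ f < ∑ g
∑-mono-< {suc k} f≤g zero    fa<ga = +-mono-<-≤ fa<ga (∑-mono (f≤g ∘ suc))
∑-mono-< {suc k} f≤g (suc a) fa<ga = +-mono-≤-< (f≤g zero) (∑-mono-< (f≤g ∘ suc) a fa<ga)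

∑-rigid : ∀ {k} {f g : Fin k → ℕ} → (∀ i → f i ≤ g i) → ∑ g ≤ ∑ f → ∀ i → f i ≡ g i
∑-rigid f≤g ∑g≤∑f i with m≤n⇒m<n∨m≡n (f≤g i)
... | inj₂ fi≡gi = fi≡gi
... | inj₁ fi<gi = contradiction ∑g≤∑f (<⇒≱ (∑-mono-< f≤g i fi<gi))

does-true : ∀ {A : Set} (a? : Dec A) → does a? ≡ true → A
does-true (yes a) _ = a

does-false : ∀ {A : Set} (a? : Dec A) → does a? ≡ false → ¬ A
does-false (no ¬a) _ = ¬a

_==_ : ∀ {k} → Fin k → Fin k → Bool
a == b = does (a Fin.≟ b)

==-refl : ∀ {k} (a : Fin k) → (a == a) ≡ true
==-refl a = dec-true (a Fin.≟ a) refl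

==-sym : ∀ {k} (a b : Fin k) → (a == b) ≡ (b == a)
==-sym a b with a Fin.≟ b | b Fin.≟ a
... | yes _   | yes _   = refl
... | no  _   | no  _   = refl
... | yes a≡b | no  b≢a = contradiction (sym a≡b) b≢a
... | no  a≢b | yes b≡a = contradiction (sym b≡a) a≢b

∑-at : ∀ {k} (a : Fin k) (f : Fin k → ℕ) → ∑ (λ i → if i == a then f i else 0) ≡ f a
∑-at {suc k} zero    f = trans (cong (f zero +_) (∑-zero {f = λ i → if suc i == zero then f (suc i) else 0} λ i → refl))
                                (+-identityʳ (f zero))
∑-at {suc k} (suc a) f = trans (sum-cong-≗ tail≡) (∑-at a (f ∘ suc))
  where
  tail≡ : ∀ i → (if suc i == suc a then f (suc i) else 0) ≡ (if i == a then f (suc i) else 0)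
  tail≡ i with i Fin.≟ a
  ... | yes _ = refl
  ... | no  _ = refl

true≢false : ∀ {b} → b ≡ true → b ≡ false → ⊥
true≢false refl ()

∨-true : ∀ a {b} → a ∨ b ≡ true → a ≡ true ⊎ b ≡ true
∨-true true  _ = inj₁ refl
∨-true false e = inj₂ e

∨-introʳ : ∀ a {b} → b ≡ true → a ∨ b ≡ true
∨-introʳ a refl = ∨-zeroʳ a

b2n≤1 : ∀ b → b2n b ≤ 1
b2n≤1 true  = s≤s z≤n
b2n≤1 false = z≤n

count : ∀ {k} → (Fin k → Bool) → ℕ
count P = ∑ (b2n ∘ P)

count-none : ∀ {k} (P : Fin k → Bool) → (∀ i → P i ≡ false) → count P ≡ 0
count-none P none = ∑-zero (cong b2n ∘ none)

count≤size : ∀ {k} (P : Fin k → Bool) → count P ≤ k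
count≤size {zero}  P = z≤n
count≤size {suc k} P = +-mono-≤ (b2n≤1 (P zero)) (count≤size (P ∘ suc))

count-mono : ∀ {k} {P Q : Fin k → Bool} → (∀ i → P i ≡ true → Q i ≡ true) → count P ≤ count Q
count-mono {P = P} {Q} P⇒Q = ∑-mono pointwise
  where
  pointwise : ∀ i → b2n (P i) ≤ b2n (Q i)
  pointwise i with P i in Pi
  ... | false = z≤n
  ... | true  rewrite P⇒Q i Pi = s≤s z≤n

count-∨ : ∀ {k} (P Q : Fin k → Bool) → count (λ i → P i ∨ Q i) ≤ count P + count Q
count-∨ P Q = ≤-trans (∑-mono λ i → pointwise (P i) (Q i)) (≤-reflexive (∑-distrib-+ (b2n ∘ P) (b2n ∘ Q)))
  where
  pointwise : ∀ a b → b2n (a ∨ b) ≤ b2n a + b2n b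
  pointwise true  b = s≤s z≤n
  pointwise false b = ≤-refl

count-split : ∀ {k} (P Q : Fin k → Bool) → count P ≡ count (λ i → P i ∧ Q i) + count (λ i → P i ∧ not (Q i))
count-split P Q = trans (sum-cong-≗ λ i → pointwise (P i) (Q i)) (∑-distrib-+ (λ i → b2n (P i ∧ Q i)) (λ i → b2n (P i ∧ not (Q i))))
  where
  pointwise : ∀ a b → b2n a ≡ b2n (a ∧ b) + b2n (a ∧ not b)
  pointwise true  true  = refl
  pointwise true  false = refl
  pointwise false b     = refl

count-at : ∀ {k} (P : Fin k → Bool) (a : Fin k) → count (λ i → P i ∧ (i == a)) ≡ b2n (P a)
count-at P a = trans (sum-cong-≗ pointwise) (∑-at a (b2n ∘ P))
  where
  pointwise : ∀ i → b2n (P i ∧ (i == a)) ≡ (if i == a then b2n (P i) else 0)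
  pointwise i with i == a
  ... | true  = cong b2n (∧-identityʳ (P i))
  ... | false = cong b2n (∧-zeroʳ (P i))

_∖_ : ∀ {k} → (Fin k → Bool) → Fin k → (Fin k → Bool)
(P ∖ a) i = P i ∧ not (i == a)

count-remove : ∀ {k} (P : Fin k → Bool) (a : Fin k) → count P ≡ b2n (P a) + count (P ∖ a)
count-remove P a = trans (count-split P (_== a)) (cong (_+ count (P ∖ a)) (count-at P a))

∖-keeps : ∀ {k} (P : Fin k → Bool) {a b} → P b ≡ true → b ≢ a → (P ∖ a) b ≡ true
∖-keeps P Pb b≢a = cong₂ _∧_ Pb (cong not (dec-false (_ Fin.≟ _) b≢a))

search : ∀ {k} (P : Fin k → Bool) → Dec (∃[ i ] (P i ≡ true))
search P = any? (λ i → P i ≟ᵇ true)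

count-pos : ∀ {k} (P : Fin k → Bool) → 1 ≤ count P → ∃[ i ] (P i ≡ true)
count-pos P 1≤ with search P
... | yes found = found
... | no  none  = contradiction (count-none P λ i → ¬-not λ Pi → none (i , Pi)) λ c≡0 → 1+n≰n (subst (1 ≤_) c≡0 1≤)

count-remove-member : ∀ {k} (P : Fin k → Bool) {a : Fin k} → P a ≡ true → count P ≡ suc (count (P ∖ a))
count-remove-member P {a} Pa = trans (count-remove P a) (cong (λ b → b2n b + count (P ∖ a)) Pa)

count-≥1 : ∀ {k} (P : Fin k → Bool) {a : Fin k} → P a ≡ true → 1 ≤ count P
count-≥1 P Pa = subst (1 ≤_) (sym (count-remove-member P Pa)) (s≤s z≤n)

count-≥2 : ∀ {k} (P : Fin k → Bool) {a b : Fin k} → P a ≡ true → P b ≡ true → a ≢ b → 2 ≤ count P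
count-≥2 P Pa Pb a≢b =
  subst (2 ≤_) (sym (count-remove-member P Pa)) (s≤s (count-≥1 (P ∖ _) (∖-keeps P Pb (a≢b ∘ sym))))

count-≥3 : ∀ {k} (P : Fin k → Bool) {a b c : Fin k} → P a ≡ true → P b ≡ true → P c ≡ true →
           a ≢ b → a ≢ c → b ≢ c → 3 ≤ count P
count-≥3 P Pa Pb Pc a≢b a≢c b≢c =
  subst (3 ≤_) (sym (count-remove-member P Pa))
    (s≤s (count-≥2 (P ∖ _) (∖-keeps P Pb (a≢b ∘ sym)) (∖-keeps P Pc (a≢c ∘ sym)) b≢c))

count≤1-unique : ∀ {k} (P : Fin k → Bool) → count P ≤ 1 → ∀ {a b} → P a ≡ true → P b ≡ true → a ≡ b
count≤1-unique P c≤1 {a} {b} Pa Pb with a Fin.≟ b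
... | yes a≡b = a≡b
... | no  a≢b = contradiction (≤-trans (count-≥2 P Pa Pb a≢b) c≤1) λ { (s≤s ()) }

choose : ∀ {k} → (Fin k → Bool) → Maybe (Fin k)
choose P with search P
... | yes (i , _) = just i
... | no  _       = nothing

choose-sound : ∀ {k} (P : Fin k → Bool) {a} → choose P ≡ just a → P a ≡ true
choose-sound P e with search P
choose-sound P refl | yes (i , Pi) = Pi

choose-unique : ∀ {k} (P : Fin k → Bool) → count P ≤ 1 → ∀ {a} → P a ≡ true → choose P ≡ just a
choose-unique P P≤1 Pa with search P
... | yes (i , Pi) = cong just (count≤1-unique P P≤1 Pi Pa)
... | no  none     = contradiction (_ , Pa) none

count-point : ∀ {k} (a : Fin k) → count (_== a) ≡ 1
count-point a = count-at (λ _ → true) a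

∖-sub : ∀ {k} (P : Fin k → Bool) {a i} → (P ∖ a) i ≡ true → P i ≡ true
∖-sub P {a} {i} = ∧-conicalˡ (P i) _

mask : Bool → ℕ → ℕ
mask b x = if b then x else 0

∑-mask-const : ∀ {k} (S : Fin k → Bool) c → ∑ (λ v → mask (S v) c) ≡ c * count S
∑-mask-const {zero}  S c = sym (*-zeroʳ c)
∑-mask-const {suc k} S c =
  trans (cong (mask (S zero) c +_) (∑-mask-const (S ∘ suc) c))
        (trans (cong (_+ c * count (S ∘ suc)) (head≡ (S zero))) (sym (*-distribˡ-+ c (b2n (S zero)) _)))
  where
  head≡ : ∀ b → mask b c ≡ c * b2n b
  head≡ true  = sym (*-identityʳ c)
  head≡ false = sym (*-zeroʳ c)

∑-mask-mono : ∀ {k} (S : Fin k → Bool) {f g : Fin k → ℕ} → (∀ v → S v ≡ true → f v ≤ g v) →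
              ∑ (λ v → mask (S v) (f v)) ≤ ∑ (λ v → mask (S v) (g v))
∑-mask-mono S {f} {g} f≤g = ∑-mono pointwise
  where
  pointwise : ∀ v → mask (S v) (f v) ≤ mask (S v) (g v)
  pointwise v with S v in Sv
  ... | true  = f≤g v Sv
  ... | false = z≤n

mask-+ : ∀ b x y → mask b (x + y) ≡ mask b x + mask b y
mask-+ true  x y = refl
mask-+ false x y = refl

mask-count : ∀ {k} b (P : Fin k → Bool) → mask b (count P) ≡ count (λ u → b ∧ P u)
mask-count true  P = refl
mask-count false P = sym (count-none (λ u → false ∧ P u) λ _ → refl)

Colour : Set
Colour = Fin 3

Proper : ∀ {k} → (Fin k → Fin k → Bool) → (Fin k → Colour) → Set
Proper R g = ∀ u v → R u v ≡ true → g u ≢ g v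

nbrsIn : ∀ {k} → (Fin k → Fin k → Bool) → (Fin k → Bool) → Fin k → Fin k → Bool
nbrsIn R S v u = S u ∧ (R v u ∨ R u v)

TwoDegenerate : ∀ {k} → (Fin k → Fin k → Bool) → Set
TwoDegenerate R = ∀ S → 1 ≤ count S → ∃[ v ] (S v ≡ true × count (nbrsIn R S v) ≤ 2)

free-colour : ∀ {k} (T : Fin k → Bool) (g : Fin k → Colour) → count T ≤ 2 →
              ∃[ c ] (∀ u → T u ≡ true → g u ≢ c)
free-colour {k} T g T≤2 with any? (uses? zero) | any? (uses? (suc zero)) | any? (uses? (suc (suc zero)))
  where
  uses : Colour → Fin k → Set
  uses c u = T u ≡ true × g u ≡ c
  uses? : ∀ c u → Dec (uses c u)
  uses? c u = (T u ≟ᵇ true) ×-dec (g u Fin.≟ c)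
... | no unused | _ | _ = zero , λ u Tu gu≡c → unused (u , Tu , gu≡c)
... | yes _ | no unused | _ = suc zero , λ u Tu gu≡c → unused (u , Tu , gu≡c)
... | yes _ | yes _ | no unused = suc (suc zero) , λ u Tu gu≡c → unused (u , Tu , gu≡c)
... | yes (u₀ , T₀ , g₀) | yes (u₁ , T₁ , g₁) | yes (u₂ , T₂ , g₂) =
  contradiction (≤-trans (count-≥3 T T₀ T₁ T₂ (apart g₀ g₁ λ ()) (apart g₀ g₂ λ ()) (apart g₁ g₂ λ ())) T≤2)
                λ { (s≤s (s≤s ())) }
  where
  apart : ∀ {a b ca cb} → g a ≡ ca → g b ≡ cb → ca ≢ cb → a ≢ b
  apart ga gb ca≢cb refl = ca≢cb (trans (sym ga) gb)

-- Colour S by removing a vertex v with at most two neighbours in S, colouring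
-- S ∖ v recursively and giving v a colour missing on its neighbours.
module GreedyColouring {k} (R : Fin k → Fin k → Bool) (irreflexive : ∀ v → R v v ≡ false)
                       (degenerate : TwoDegenerate R) where

  ProperOn : (Fin k → Bool) → (Fin k → Colour) → Set
  ProperOn S g = ∀ u w → S u ≡ true → S w ≡ true → R u w ≡ true → g u ≢ g w

  extend : ∀ S v g c → ProperOn (S ∖ v) g → (∀ u → nbrsIn R (S ∖ v) v u ≡ true → g u ≢ c) →
           ProperOn S (updateAt g v (const c))
  extend S v g c proper avoid u w Su Sw Ruw with u Fin.≟ v | w Fin.≟ v
  ... | yes refl | yes refl = λ _ → true≢false Ruw (irreflexive u)
  ... | yes refl | no w≢v = λ same →
    avoid w (cong₂ _∧_ (∖-keeps S Sw w≢v) (cong (_∨ R w v) Ruw))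
            (trans (sym (updateAt-minimal w v g w≢v)) (trans (sym same) (updateAt-updates v g)))
  ... | no u≢v | yes refl = λ same →
    avoid u (cong₂ _∧_ (∖-keeps S Su u≢v) (∨-introʳ (R w u) Ruw))
            (trans (sym (updateAt-minimal u w g u≢v)) (trans same (updateAt-updates w g)))
  ... | no u≢v | no w≢v = λ same →
    proper u w (∖-keeps S Su u≢v) (∖-keeps S Sw w≢v) Ruw
           (trans (sym (updateAt-minimal u v g u≢v)) (trans same (updateAt-minimal w v g w≢v)))

  fewer : ∀ S v u → nbrsIn R (S ∖ v) v u ≡ true → nbrsIn R S v u ≡ true
  fewer S v u e = cong₂ _∧_ (∖-sub S (∧-conicalˡ ((S ∖ v) u) _ e)) (∧-conicalʳ ((S ∖ v) u) _ e)

  colourSubset : ∀ m S → count S ≤ m → ∃[ g ] ProperOn S g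
  colourSubset m S _ with 1 ≤? count S
  ... | no empty = (λ _ → zero) , λ u _ Su → contradiction (count-≥1 S Su) empty
  colourSubset zero    S S≤0 | yes S≥1 = contradiction (≤-trans S≥1 S≤0) λ ()
  colourSubset (suc m) S S≤m+1 | yes S≥1 with degenerate S S≥1
  ... | v , Sv , few with colourSubset m (S ∖ v) (≤-pred (subst (_≤ suc m) (count-remove-member S Sv) S≤m+1))
  ... | g , proper with free-colour (nbrsIn R (S ∖ v) v) g
                          (≤-trans (count-mono (fewer S v)) few)
  ... | c , avoid = updateAt g v (const c) , extend S v g c proper avoid

  colouring : ∃[ g ] Proper R g
  colouring with colourSubset k (λ _ → true) (count≤size _)
  ... | g , proper = g , λ u w → proper u w refl refl

-- A loopless relation in which every vertex has out-degree at most one, except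
-- possibly a single vertex of out-degree two, is 2-degenerate: a vertex set S
-- spans at most |S| + 1 edges, so if every vertex of S had three neighbours in S
-- then 3|S| ≤ 2(|S| + 1), i.e. |S| ≤ 2, leaving room for at most one neighbour.
module SparseRelation {k} (R : Fin k → Fin k → Bool) (irreflexive : ∀ v → R v v ≡ false)
                      (X : Fin k → Bool) (X≤1 : count X ≤ 1)
                      (out-bound : ∀ u → count (R u) ≤ 1 + b2n (X u)) where

  outIn inIn : (Fin k → Bool) → Fin k → ℕ
  outIn S v = count (λ u → S u ∧ R v u)
  inIn  S v = count (λ u → S u ∧ R u v)

  degree≤out+in : ∀ S v → count (nbrsIn R S v) ≤ outIn S v + inIn S v
  degree≤out+in S v = ≤-trans (∑-mono λ u → pointwise (S u) (R v u) (R u v))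
                              (count-∨ (λ u → S u ∧ R v u) (λ u → S u ∧ R u v))
    where
    pointwise : ∀ s a b → b2n (s ∧ (a ∨ b)) ≤ b2n ((s ∧ a) ∨ (s ∧ b))
    pointwise false a     b = z≤n
    pointwise true  true  b = ≤-refl
    pointwise true  false b = ≤-refl

  -- v is not its own neighbour.
  degree≤size : ∀ S v → count (nbrsIn R S v) ≤ count (S ∖ v)
  degree≤size S v = count-mono λ u e → cong₂ _∧_ (∧-conicalˡ _ _ e) (cong not (dec-false (u Fin.≟ v) (not-self u e)))
    where
    not-self : ∀ u → nbrsIn R S v u ≡ true → u ≢ v
    not-self u e refl rewrite irreflexive u = true≢false (∧-conicalʳ (S u) _ e) refl

  ∑in≡∑out : ∀ S → ∑ (λ v → mask (S v) (inIn S v)) ≡ ∑ (λ v → mask (S v) (outIn S v))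
  ∑in≡∑out S = begin
    ∑ (λ v → mask (S v) (inIn S v))              ≡⟨ sum-cong-≗ (λ v → mask-count (S v) (λ u → S u ∧ R u v)) ⟩
    ∑ (λ v → ∑ (λ u → b2n (S v ∧ (S u ∧ R u v)))) ≡⟨ ∑-comm (λ v u → b2n (S v ∧ (S u ∧ R u v))) ⟩
    ∑ (λ u → ∑ (λ v → b2n (S v ∧ (S u ∧ R u v)))) ≡⟨ sum-cong-≗ (λ u → sum-cong-≗ λ v → cong b2n (swap (S v) (S u) (R u v))) ⟩
    ∑ (λ u → count (λ v → S u ∧ (S v ∧ R u v)))   ≡⟨ sum-cong-≗ (λ u → mask-count (S u) (λ v → S v ∧ R u v)) ⟨
    ∑ (λ u → mask (S u) (outIn S u))             ∎
    where
    open ≡-Reasoning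
    swap : ∀ a b c → a ∧ (b ∧ c) ≡ b ∧ (a ∧ c)
    swap true  b     c = refl
    swap false true  c = refl
    swap false false c = refl

  ∑out≤ : ∀ S → ∑ (λ v → mask (S v) (outIn S v)) ≤ count S + 1
  ∑out≤ S = begin
    ∑ (λ v → mask (S v) (outIn S v))   ≤⟨ ∑-mask-mono S (λ v _ → ≤-trans (count-mono λ u e → ∧-conicalʳ (S u) _ e) (out-bound v)) ⟩
    ∑ (λ v → mask (S v) (1 + b2n (X v))) ≤⟨ ∑-mono (λ v → pointwise (S v) (X v)) ⟩
    ∑ (λ v → b2n (S v) + b2n (X v))     ≡⟨ ∑-distrib-+ (b2n ∘ S) (b2n ∘ X) ⟩
    count S + count X                   ≤⟨ +-monoʳ-≤ (count S) X≤1 ⟩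
    count S + 1                         ∎
    where
    open ≤-Reasoning
    pointwise : ∀ s x → mask s (1 + b2n x) ≤ b2n s + b2n x
    pointwise true  x = ≤-refl
    pointwise false x = z≤n

  crowded⇒small : ∀ S → (∀ v → S v ≡ true → 3 ≤ count (nbrsIn R S v)) → count S ≤ 2
  crowded⇒small S crowded = 3s≤2s+2⇒s≤2 (count S) (begin
    3 * count S                                            ≡⟨ ∑-mask-const S 3 ⟨
    ∑ (λ v → mask (S v) 3)                                  ≤⟨ ∑-mask-mono S crowded ⟩
    ∑ (λ v → mask (S v) (count (nbrsIn R S v)))             ≤⟨ ∑-mask-mono S (λ v _ → degree≤out+in S v) ⟩
    ∑ (λ v → mask (S v) (outIn S v + inIn S v))             ≡⟨ sum-cong-≗ (λ v → mask-+ (S v) (outIn S v) (inIn S v)) ⟩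
    ∑ (λ v → mask (S v) (outIn S v) + mask (S v) (inIn S v)) ≡⟨ ∑-distrib-+ (λ v → mask (S v) (outIn S v)) _ ⟩
    ∑ (λ v → mask (S v) (outIn S v)) + ∑ (λ v → mask (S v) (inIn S v))
                                                           ≡⟨ cong (∑ (λ v → mask (S v) (outIn S v)) +_) (∑in≡∑out S) ⟩
    ∑ (λ v → mask (S v) (outIn S v)) + ∑ (λ v → mask (S v) (outIn S v))
                                                           ≤⟨ +-mono-≤ (∑out≤ S) (∑out≤ S) ⟩
    (count S + 1) + (count S + 1)                          ≡⟨ cong (count S + 1 +_) (+-identityʳ _) ⟨
    2 * (count S + 1)                                      ∎)
    where
    open ≤-Reasoning
    3s≤2s+2⇒s≤2 : ∀ s → 3 * s ≤ 2 * (s + 1) → s ≤ 2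
    3s≤2s+2⇒s≤2 s le = +-cancelʳ-≤ (2 * s) s 2 (subst (s + 2 * s ≤_) (trans (*-distribˡ-+ 2 s 1) (+-comm (2 * s) 2)) le)

  twoDegenerate : TwoDegenerate R
  twoDegenerate S S≥1 with any? (λ v → (S v ≟ᵇ true) ×-dec (count (nbrsIn R S v) ≤? 2))
  ... | yes found = found
  ... | no none with count-pos S S≥1
  ... | v , Sv = contradiction (≤-trans (crowded v Sv) (≤-trans (degree≤size S v) rest≤1)) λ { (s≤s ()) }
    where
    crowded : ∀ v → S v ≡ true → 3 ≤ count (nbrsIn R S v)
    crowded v Sv = ≰⇒> λ few → none (v , Sv , few)
    rest≤1 : count (S ∖ v) ≤ 1
    rest≤1 = ≤-pred (subst (_≤ 2) (count-remove-member S Sv) (crowded⇒small S crowded))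

anyᵇ : ∀ {k} → (Fin k → Bool) → Bool
anyᵇ P = does (search P)

anyᵇ-intro : ∀ {k} (P : Fin k → Bool) {i} → P i ≡ true → anyᵇ P ≡ true
anyᵇ-intro P {i} Pi = dec-true (search P) (i , Pi)

anyᵇ-elim : ∀ {k} (P : Fin k → Bool) → anyᵇ P ≡ true → ∃[ i ] (P i ≡ true)
anyᵇ-elim P = does-true (search P)

anyᵇ≤count : ∀ {k} (P : Fin k → Bool) → b2n (anyᵇ P) ≤ count P
anyᵇ≤count P with search P
... | yes (i , Pi) = count-≥1 P Pi
... | no  _        = z≤n

count-anyᵇ : ∀ {k} (A : Fin k → Bool) (B : Fin k → Fin k → Bool) →
             count (λ b → anyᵇ (λ u → A u ∧ B u b)) ≤ ∑ (λ u → mask (A u) (count (B u)))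
count-anyᵇ A B = ≤-trans (∑-mono λ b → anyᵇ≤count (λ u → A u ∧ B u b))
  (≤-reflexive (trans (∑-comm (λ b u → b2n (A u ∧ B u b))) (sum-cong-≗ λ u → sym (mask-count (A u) (B u)))))

hits : ∀ {k} → Maybe (Fin k) → (Fin k → Bool) → Bool
hits nothing  P = false
hits (just v) P = P v

hits-just : ∀ {k} {m : Maybe (Fin k)} {P} → hits m P ≡ true → ∃[ v ] (m ≡ just v × P v ≡ true)
hits-just {m = just v} Pv = v , refl , Pv

-- A partial function p : V → Maybe V is read as the graph with edges u — p u.
ProperFor : ∀ {k} → (Fin k → Maybe (Fin k)) → (Fin k → Colour) → Set
ProperFor p h = ∀ u v → p u ≡ just v → h u ≢ h v

-- Identify
-- y with x (the map ρ): the contracted graph is loopless, every vertex has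
-- out-degree at most one except x, which has out-degree at most two; so it is
-- 2-degenerate and greedy colouring applies.
module Contraction {k} (p : Fin k → Maybe (Fin k)) (fixpoint-free : ∀ u → p u ≢ just u)
                   (x y : Fin k) (x↛y : p x ≢ just y) (y↛x : p y ≢ just x) where

  ρ : Fin k → Fin k
  ρ u = if u == y then x else u

  Q : Fin k → Fin k → Bool
  Q a b = anyᵇ λ u → (ρ u == a) ∧ hits (p u) (λ v → ρ v == b)

  ρ-identifies : ρ x ≡ ρ y
  ρ-identifies = trans ρx≡x (sym (cong (λ b → if b then x else y) (==-refl y)))
    where
    ρx≡x : ρ x ≡ x
    ρx≡x with x == y
    ... | true  = refl
    ... | false = refl

  ρ-merges-only-x-y : ∀ u v → ρ u ≡ ρ v → u ≡ v ⊎ ((u ≡ x × v ≡ y) ⊎ (u ≡ y × v ≡ x))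
  ρ-merges-only-x-y u v e with u Fin.≟ y | v Fin.≟ y
  ... | yes u≡y | yes v≡y = inj₁ (trans u≡y (sym v≡y))
  ... | no  _   | no  _   = inj₁ e
  ... | no  _   | yes v≡y = inj₂ (inj₁ (e , v≡y))
  ... | yes u≡y | no  _   = inj₂ (inj₂ (u≡y , sym e))

  -- A loop of Q would be a fixed point of p or an edge between x and y.
  Q-irreflexive : ∀ a → Q a a ≡ false
  Q-irreflexive a with Q a a in Qaa
  ... | false = refl
  ... | true with anyᵇ-elim _ Qaa
  ... | u , e with hits-just {m = p u} (∧-conicalʳ (ρ u == a) _ e)
  ... | v , pu≡v , ρv≡a
    with ρ-merges-only-x-y u v (trans (does-true (_ Fin.≟ _) (∧-conicalˡ (ρ u == a) _ e))
                                      (sym (does-true (_ Fin.≟ _) ρv≡a)))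
  ... | inj₁ refl                = contradiction pu≡v (fixpoint-free u)
  ... | inj₂ (inj₁ (refl , refl)) = contradiction pu≡v x↛y
  ... | inj₂ (inj₂ (refl , refl)) = contradiction pu≡v y↛x

  -- Only a itself, and y when a = x, are mapped to a.
  preimage-size : ∀ a → count (λ u → ρ u == a) ≤ 1 + b2n (x == a)
  preimage-size a = ≤-trans (count-mono preimage) (≤-trans (count-∨ (_== a) (λ u → (u == y) ∧ (x == a)))
                      (≤-reflexive (cong₂ _+_ (count-point a) (y-term (x == a)))))
    where
    preimage : ∀ u → (ρ u == a) ≡ true → ((u == a) ∨ ((u == y) ∧ (x == a))) ≡ true
    preimage u e with u Fin.≟ y
    ... | yes refl = ∨-introʳ (u == a) e
    ... | no  _    = cong (_∨ false) e
    y-term : ∀ c → count (λ u → (u == y) ∧ c) ≡ b2n c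
    y-term c = trans (sum-cong-≗ λ u → cong b2n (∧-comm (u == y) c)) (count-at (λ _ → c) y)

  -- Every preimage u of a contributes at most its one successor p u.
  Q-out-degree : ∀ a → count (Q a) ≤ 1 + b2n (a == x)
  Q-out-degree a =
    ≤-trans (count-anyᵇ (λ u → ρ u == a) (λ u b → hits (p u) (λ v → ρ v == b)))
            (≤-trans (∑-mono single-successor)
                     (subst (λ b → count (λ u → ρ u == a) ≤ 1 + b2n b) (==-sym x a) (preimage-size a)))
    where
    successors≤1 : ∀ u → count (λ b → hits (p u) (λ v → ρ v == b)) ≤ 1
    successors≤1 u with p u
    ... | nothing = subst (_≤ 1) (sym (count-none {k} (λ _ → false) λ _ → refl)) z≤n
    ... | just v  = ≤-reflexive (trans (sum-cong-≗ λ b → cong b2n (==-sym (ρ v) b)) (count-point (ρ v)))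
    single-successor : ∀ u → mask (ρ u == a) (count (λ b → hits (p u) (λ v → ρ v == b))) ≤ b2n (ρ u == a)
    single-successor u with ρ u == a
    ... | true  = successors≤1 u
    ... | false = z≤n

  open SparseRelation Q Q-irreflexive (_== x) (≤-reflexive (count-point x)) Q-out-degree using (twoDegenerate)
  open GreedyColouring Q Q-irreflexive twoDegenerate using (colouring)

  merged-colouring : Σ (Fin k → Colour) λ h → ProperFor p h × h x ≡ h y
  merged-colouring = proj₁ colouring ∘ ρ , proper , cong (proj₁ colouring) ρ-identifies
    where
    proper : ProperFor p (proj₁ colouring ∘ ρ)
    proper u v pu≡v = proj₂ colouring (ρ u) (ρ v)
      (anyᵇ-intro _ {u} (cong₂ _∧_ (==-refl (ρ u)) (subst (λ m → hits m (λ w → ρ w == ρ v) ≡ true) (sym pu≡v) (==-refl (ρ v)))))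

open Contraction using (merged-colouring)

colour-functional : ∀ {k} (p : Fin k → Maybe (Fin k)) → (∀ u → p u ≢ just u) → Σ (Fin k → Colour) (ProperFor p)
colour-functional {zero}  p _             = (λ ()) , λ ()
colour-functional {suc k} p fixpoint-free =
  let h , proper , _ = merged-colouring p fixpoint-free zero zero (fixpoint-free zero) (fixpoint-free zero)
  in h , proper

d⁻ d⁺ : (D : Digraph) → Fin (n D) → ℕ
d⁻ D v = count (λ x → E D x v)
d⁺ D v = count (E D v)

no-loop : ∀ D {a b} → E D a b ≡ true → a ≢ b
no-loop D {a} e refl = true≢false e (loopless D a)

InD₁₁ : Digraph → Set
InD₁₁ D = ∀ v → d⁻ D v ≤ 1 ⊎ d⁺ D v ≤ 1

InD⇒InD₁₁ : ∀ D → InD 1 1 D → InD₁₁ D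
InD⇒InD₁₁ D inD v with inD v
... | inj₁ in≤1  = inj₁ (subst (_≤ 1) (Σᵥ≡∑ (λ x → b2n (E D x v))) in≤1)
... | inj₂ out≤1 = inj₂ (subst (_≤ 1) (Σᵥ≡∑ (λ y → b2n (E D v y))) out≤1)

double-Σᵥ≡∑ : ∀ {k} (f : Fin k → Fin k → ℕ) → Σᵥ (λ x → Σᵥ (f x)) ≡ ∑ (λ x → ∑ (f x))
double-Σᵥ≡∑ f = trans (Σᵥ≡∑ (λ x → Σᵥ (f x))) (sum-cong-≗ λ x → Σᵥ≡∑ (f x))

edges≡ : ∀ D → edges D ≡ ∑ (λ x → ∑ (λ y → b2n (E D x y)))
edges≡ D = double-Σᵥ≡∑ (λ x y → b2n (E D x y))

cutSize≡ : ∀ D X → cutSize D X ≡ ∑ (λ x → ∑ (λ y → b2n (X x ∧ not (X y) ∧ E D x y)))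
cutSize≡ D X = double-Σᵥ≡∑ (λ x y → b2n (X x ∧ not (X y) ∧ E D x y))

-- The total size of its cuts counts every edge xy
-- with multiplicity cutWeight x y, the number of cuts of the family containing
-- it; so if each edge lies in one of the cuts, the cuts have total size at least m.
module CutFamily (D : Digraph) {r} (X : Fin r → Fin (n D) → Bool) where

  cutWeight : Fin (n D) → Fin (n D) → ℕ
  cutWeight x y = count (λ i → X i x ∧ not (X i y))

  totalCut : ℕ
  totalCut = ∑ (λ i → cutSize D (X i))

  totalCut≡ : totalCut ≡ ∑ (λ x → ∑ (λ y → mask (E D x y) (cutWeight x y)))
  totalCut≡ = begin
    ∑ (λ i → cutSize D (X i))                       ≡⟨ sum-cong-≗ (λ i → cutSize≡ D (X i)) ⟩
    ∑ (λ i → ∑ (λ x → ∑ (λ y → cut i x y)))         ≡⟨ ∑-comm (λ i x → ∑ (λ y → cut i x y)) ⟩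
    ∑ (λ x → ∑ (λ i → ∑ (λ y → cut i x y)))         ≡⟨ sum-cong-≗ (λ x → ∑-comm (λ i y → cut i x y)) ⟩
    ∑ (λ x → ∑ (λ y → ∑ (λ i → cut i x y)))         ≡⟨ sum-cong-≗ (λ x → sum-cong-≗ λ y → sum-cong-≗ λ i → cong b2n (edge-first i x y)) ⟩
    ∑ (λ x → ∑ (λ y → count (λ i → E D x y ∧ (X i x ∧ not (X i y)))))
                                                    ≡⟨ sum-cong-≗ (λ x → sum-cong-≗ λ y → mask-count (E D x y) (λ i → X i x ∧ not (X i y))) ⟨
    ∑ (λ x → ∑ (λ y → mask (E D x y) (cutWeight x y))) ∎
    where
    open ≡-Reasoning
    cut : Fin r → Fin (n D) → Fin (n D) → ℕ
    cut i x y = b2n (X i x ∧ not (X i y) ∧ E D x y)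
    edge-first : ∀ i x y → (X i x ∧ not (X i y) ∧ E D x y) ≡ E D x y ∧ (X i x ∧ not (X i y))
    edge-first i x y = trans (sym (∧-assoc (X i x) _ _)) (∧-comm _ (E D x y))

  edge≤weight : (∀ x y → E D x y ≡ true → 1 ≤ cutWeight x y) → ∀ x y → b2n (E D x y) ≤ mask (E D x y) (cutWeight x y)
  edge≤weight covered x y with E D x y in Exy
  ... | true  = covered x y Exy
  ... | false = z≤n

  covered⇒ : (∀ x y → E D x y ≡ true → 1 ≤ cutWeight x y) → edges D ≤ totalCut
  covered⇒ covered = subst₂ _≤_ (sym (edges≡ D)) (sym totalCut≡)
                       (∑-mono λ x → ∑-mono λ y → edge≤weight covered x y)

  covered-twice⇒ : (∀ x y → E D x y ≡ true → 1 ≤ cutWeight x y) →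
                   ∀ x₀ y₀ → E D x₀ y₀ ≡ true → 2 ≤ cutWeight x₀ y₀ → edges D < totalCut
  covered-twice⇒ covered x₀ y₀ E₀ twice = subst₂ _<_ (sym (edges≡ D)) (sym totalCut≡)
    (∑-mono-< (λ x → ∑-mono λ y → edge≤weight covered x y) x₀
      (∑-mono-< (edge≤weight covered x₀) y₀ (subst (λ e → b2n e < mask e (cutWeight x₀ y₀)) (sym E₀) twice)))

averaging : ∀ {r} m (a : Fin (suc r) → ℕ) → m ≤ ∑ a → ∃[ i ] (m ≤ suc r * a i)
averaging {r} m a m≤∑a with any? (λ i → m ≤? suc r * a i)
... | yes found = found
... | no  none  = contradiction (begin-strict
    suc r * m                 ≤⟨ *-monoʳ-≤ (suc r) m≤∑a ⟩
    suc r * ∑ a               ≡⟨ *-distribˡ-sum (suc r) a ⟩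
    ∑ (λ i → suc r * a i)     <⟨ ∑-mono-< {f = λ i → suc r * a i} {g = λ _ → m} (λ i → <⇒≤ (below i)) zero (below zero) ⟩
    ∑ {suc r} (λ _ → m)       ≡⟨ ∑-const (suc r) m ⟩
    suc r * m                 ∎) (<-irrefl refl)
  where
  open ≤-Reasoning
  below : ∀ i → suc r * a i < m
  below i = ≰⇒> λ le → none (i , le)

best-cut : ∀ D {r} (X : Fin (suc r) → Fin (n D) → Bool) m → m ≤ CutFamily.totalCut D X →
           ∃[ Y ] (m ≤ suc r * cutSize D Y)
best-cut D X m m≤total = let i , m≤ = averaging m (λ i → cutSize D (X i)) m≤total in X i , m≤

-- Every vertex gets a type: type A
-- (τ v = true) when d⁻ v ≤ 1, type B (τ v = false) when d⁺ v ≤ 1.  Given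
-- colours c : V → Fin 3, partition i contains the A-vertices of colour ≠ i and
-- the B-vertices of colour i.  The number of partitions whose cut contains an
-- edge xy depends only on the types and colours of x and y:
--   A → A and B → B edges are cut if the colours differ,
--   B → A edges are cut if the colours agree,
--   A → B edges are always cut, and twice if the colours agree.
inPart : Bool → Colour → Fin 3 → Bool
inPart true  c i = not (c == i)
inPart false c i = c == i

cutWeight₃ : Bool → Colour → Bool → Colour → ℕ
cutWeight₃ τx cx τy cy = count (λ i → inPart τx cx i ∧ not (inPart τy cy i))

weight-AA : ∀ a b → a ≢ b → 1 ≤ cutWeight₃ true a true b
weight-AA a b a≢b = count-≥1 (λ i → not (a == i) ∧ not (not (b == i))) {b}
                      (cong₂ (λ s t → not s ∧ not (not t)) (dec-false (a Fin.≟ b) a≢b) (==-refl b))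

weight-BB : ∀ a b → a ≢ b → 1 ≤ cutWeight₃ false a false b
weight-BB a b a≢b = count-≥1 (λ i → (a == i) ∧ not (b == i)) {a}
                      (cong₂ (λ s t → s ∧ not t) (==-refl a) (dec-false (b Fin.≟ a) (a≢b ∘ sym)))

weight-BA : ∀ a → 1 ≤ cutWeight₃ false a true a
weight-BA a = count-≥1 (λ i → (a == i) ∧ not (not (a == i))) {a} (cong (λ s → s ∧ not (not s)) (==-refl a))

weight-AB : ∀ a b → 1 ≤ cutWeight₃ true a false b
weight-AB zero             zero             = s≤s z≤n
weight-AB zero             (suc zero)       = s≤s z≤n
weight-AB zero             (suc (suc zero)) = s≤s z≤n
weight-AB (suc zero)       zero             = s≤s z≤n
weight-AB (suc zero)       (suc zero)       = s≤s z≤n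
weight-AB (suc zero)       (suc (suc zero)) = s≤s z≤n
weight-AB (suc (suc zero)) zero             = s≤s z≤n
weight-AB (suc (suc zero)) (suc zero)       = s≤s z≤n
weight-AB (suc (suc zero)) (suc (suc zero)) = s≤s z≤n

weight-AB-same : ∀ a → 2 ≤ cutWeight₃ true a false a
weight-AB-same zero             = s≤s (s≤s z≤n)
weight-AB-same (suc zero)       = s≤s (s≤s z≤n)
weight-AB-same (suc (suc zero)) = s≤s (s≤s z≤n)

if-just : ∀ {A : Set} b {x v : A} → (if b then just x else nothing) ≡ just v → b ≡ true × x ≡ v
if-just true refl = refl , refl

if-nothing : ∀ {A : Set} b {x v : A} → (if b then nothing else just x) ≡ just v → b ≡ false × x ≡ v
if-nothing false refl = refl , refl

Typing : (D : Digraph) → (Fin (n D) → Bool) → Set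
Typing D τ = ∀ v → (τ v ≡ true → d⁻ D v ≤ 1) × (τ v ≡ false → d⁺ D v ≤ 1)

-- The colour of v is that of its
-- representative: an A-vertex whose in-neighbour t is a B-vertex is represented
-- by t (so B → A edges get equal colours), every other vertex by itself.  The
-- remaining edges that must get distinct colours form the graph of a partial
-- function `conflict`: an A-vertex with an A in-neighbour t conflicts with the
-- representative of t, and a B-vertex with a B out-neighbour w conflicts with w.
module Constraints (D : Digraph) (τ : Fin (n D) → Bool) (typing : Typing D τ) where

  V : Set
  V = Fin (n D)

  inNbr outNbr : V → Maybe V
  inNbr  v = choose (λ x → E D x v)
  outNbr v = choose (E D v)

  rep′ : Bool → Maybe V → V → V
  rep′ true (just t) v = if τ t then v else t
  rep′ _    _        v = v

  rep : V → V
  rep v = rep′ (τ v) (inNbr v) v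

  conflict′ : Bool → Maybe V → Maybe V → Maybe V
  conflict′ true  nothing  _        = nothing
  conflict′ true  (just t) _        = if τ t then just (rep t) else nothing
  conflict′ false _        nothing  = nothing
  conflict′ false _        (just w) = if τ w then nothing else just w

  conflict : V → Maybe V
  conflict v = conflict′ (τ v) (inNbr v) (outNbr v)

  inNbr-edge : ∀ {t v} → inNbr v ≡ just t → E D t v ≡ true
  inNbr-edge {v = v} = choose-sound (λ x → E D x v)

  outNbr-edge : ∀ {w v} → outNbr v ≡ just w → E D v w ≡ true
  outNbr-edge {v = v} = choose-sound (E D v)

  inNbr-unique : ∀ {u w} → τ w ≡ true → E D u w ≡ true → inNbr w ≡ just u
  inNbr-unique {w = w} τw = choose-unique (λ x → E D x w) (proj₁ (typing w) τw)

  outNbr-unique : ∀ {u w} → τ u ≡ false → E D u w ≡ true → outNbr u ≡ just w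
  outNbr-unique {u} τu = choose-unique (E D u) (proj₂ (typing u) τu)

  rep-B : ∀ {v} → τ v ≡ false → rep v ≡ v
  rep-B τv rewrite τv = refl

  rep-A : ∀ t → τ t ≡ true → rep t ≡ t ⊎ (E D (rep t) t ≡ true × τ (rep t) ≡ false)
  rep-A t τt rewrite τt with inNbr t in in-t
  ... | nothing = inj₁ refl
  ... | just s with τ s in τs
  ...   | true  = inj₁ refl
  ...   | false = inj₂ (inNbr-edge in-t , τs)

  conflict-A : ∀ {u v} → τ u ≡ true → conflict u ≡ just v → ∃[ t ] (inNbr u ≡ just t × τ t ≡ true × v ≡ rep t)
  conflict-A {u} τu e rewrite τu with inNbr u
  ... | just t = let τt , rep-t≡v = if-just (τ t) e in t , refl , τt , sym rep-t≡v

  conflict-B : ∀ {u v} → τ u ≡ false → conflict u ≡ just v → outNbr u ≡ just v × τ v ≡ false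
  conflict-B {u} τu e rewrite τu with outNbr u
  ... | just w = let τw , w≡v = if-nothing (τ w) e in cong just w≡v , subst (λ z → τ z ≡ false) w≡v τw

  conflict-fixpoint-free : ∀ u → conflict u ≢ just u
  conflict-fixpoint-free u e = by-type (τ u) refl
    where
    by-type : ∀ b → τ u ≡ b → ⊥
    by-type true τu with conflict-A τu e
    ... | t , in-u , τt , u≡rep-t with rep-A t τt
    ...   | inj₁ rep-t≡t = no-loop D (subst (λ z → E D z u ≡ true) (trans (sym rep-t≡t) (sym u≡rep-t)) (inNbr-edge in-u)) refl
    ...   | inj₂ (_ , τrep) = true≢false τu (trans (cong τ u≡rep-t) τrep)
    by-type false τu = no-loop D (outNbr-edge (proj₁ (conflict-B τu e))) refl

  conflict-AA : ∀ {u w} → E D u w ≡ true → τ u ≡ true → τ w ≡ true → conflict w ≡ just (rep u) × rep w ≡ w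
  conflict-AA {u} {w} e τu τw rewrite τw | inNbr-unique τw e | τu = refl , refl

  conflict-BB : ∀ {u w} → E D u w ≡ true → τ u ≡ false → τ w ≡ false → conflict u ≡ just w
  conflict-BB {u} {w} e τu τw rewrite τu | outNbr-unique τu e | τw = refl

  rep-BA : ∀ {u w} → E D u w ≡ true → τ u ≡ false → τ w ≡ true → rep w ≡ u
  rep-BA {u} {w} e τu τw rewrite τw | inNbr-unique τw e | τu = refl

  colouring : Σ (V → Colour) (ProperFor conflict)
  colouring = colour-functional conflict conflict-fixpoint-free

  module ThreeCuts (h : V → Colour) (proper : ProperFor conflict h) where

    colour : V → Colour
    colour v = h (rep v)

    parts : Fin 3 → V → Bool
    parts i v = inPart (τ v) (colour v) i

    open CutFamily D parts public

    covered : ∀ x y → E D x y ≡ true → 1 ≤ cutWeight x y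
    covered x y e = by-types (τ x) (τ y) refl refl
      where
      by-types : ∀ tx ty → τ x ≡ tx → τ y ≡ ty → 1 ≤ cutWeight₃ tx (colour x) ty (colour y)
      by-types true true τx τy =
        let conf , rep-y = conflict-AA e τx τy
        in weight-AA (colour x) (colour y) λ same → proper y (rep x) conf (trans (cong h (sym rep-y)) (sym same))
      by-types false false τx τy =
        weight-BB (colour x) (colour y) λ same →
          proper x y (conflict-BB e τx τy) (trans (cong h (sym (rep-B {x} τx))) (trans same (cong h (rep-B {y} τy))))
      by-types false true τx τy =
        subst (λ c → 1 ≤ cutWeight₃ false (colour x) true c) (cong h (trans (rep-B {x} τx) (sym (rep-BA e τx τy))))
              (weight-BA (colour x))
      by-types true false τx τy = weight-AB (colour x) (colour y)

    covered-twice : ∀ x y → τ x ≡ true → τ y ≡ false → colour x ≡ colour y → 2 ≤ cutWeight x y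
    covered-twice x y τx τy same =
      subst₂ (λ tx ty → 2 ≤ cutWeight₃ tx (colour x) ty (colour y)) (sym τx) (sym τy)
        (subst (λ c → 2 ≤ cutWeight₃ true (colour x) false c) same (weight-AB-same (colour x)))

defaultType : (D : Digraph) → Fin (n D) → Bool
defaultType D v = does (d⁻ D v ≤? 1)

defaultTyping : ∀ D → InD₁₁ D → Typing D (defaultType D)
defaultTyping D D11 v = is-A , is-B
  where
  is-A : defaultType D v ≡ true → d⁻ D v ≤ 1
  is-A = does-true (d⁻ D v ≤? 1)
  is-B : defaultType D v ≡ false → d⁺ D v ≤ 1
  is-B not-A with D11 v
  ... | inj₁ in≤1  = contradiction in≤1 (does-false (d⁻ D v ≤? 1) not-A)
  ... | inj₂ out≤1 = out≤1

large-cut : ∀ D → InD₁₁ D → ∃[ X ] (edges D ≤ 3 * cutSize D X)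
large-cut D D11 = best-cut D parts (edges D) (covered⇒ covered)
  where
  open Constraints D (defaultType D) (defaultTyping D D11)
  open ThreeCuts (proj₁ colouring) (proj₂ colouring)

OnTriangle : (D : Digraph) → Fin (n D) → Fin (n D) → Set
OnTriangle D u v = ∃[ x ] (E D v x ≡ true × E D x u ≡ true)

-- An edge uw with d⁻ u ≤ 1 and d⁺ w ≤ 1 that is not on a triangle gives a cut
-- of size > m/3.  Type u as A and w as B.  The endpoints w and rep u are not
-- in conflict (a conflict would close a triangle through uw), so the colouring
-- can give them the same colour; then colour u = colour w and the A → B edge uw
-- is cut twice, making the three cuts total more than m.
module EdgeOffTriangle (D : Digraph) (D11 : InD₁₁ D) (u w : Fin (n D)) (uw : E D u w ≡ true)
                       (in-u : d⁻ D u ≤ 1) (out-w : d⁺ D w ≤ 1) (off : ¬ OnTriangle D u w) where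

  -- The endpoints are distinct, so the typing below is consistent.
  u≢w : u ≢ w
  u≢w = no-loop D uw

  τ : Fin (n D) → Bool
  τ x = if x == u then true else (if x == w then false else defaultType D x)

  τu : τ u ≡ true
  τu = cong (λ b → if b then true else (if u == w then false else defaultType D u)) (==-refl u)

  τw : τ w ≡ false
  τw = trans (cong (λ b → if b then true else (if w == w then false else defaultType D w)) (dec-false (w Fin.≟ u) (u≢w ∘ sym)))
             (cong (λ b → if b then false else defaultType D w) (==-refl w))

  typing : Typing D τ
  typing x with x Fin.≟ u | x Fin.≟ w
  ... | yes refl | _        = (λ _ → in-u) , λ ()
  ... | no  _    | yes refl = (λ ()) , (λ _ → out-w)
  ... | no  _    | no  _    = defaultTyping D D11 x

  open Constraints D τ typing

  -- Neither of w, rep u conflicts with the other: either conflict closes a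
  -- triangle through uw or contradicts the types.
  w↛rep-u : conflict w ≢ just (rep u)
  w↛rep-u e with conflict-B τw e
  ... | out-w≡ , τrep with rep-A u τu
  ...   | inj₁ rep-u≡u       = true≢false τu (subst (λ z → τ z ≡ false) rep-u≡u τrep)
  ...   | inj₂ (rep-u→u , _) = off (rep u , outNbr-edge out-w≡ , rep-u→u)

  rep-u↛w : conflict (rep u) ≢ just w
  rep-u↛w e with rep-A u τu
  ... | inj₁ rep-u≡u with conflict-A τu (subst (λ z → conflict z ≡ just w) rep-u≡u e)
  ...   | t , in-u≡t , τt , w≡rep-t with rep-A t τt
  ...     | inj₁ rep-t≡t = true≢false (subst (λ z → τ z ≡ true) (sym (trans w≡rep-t rep-t≡t)) τt) τw
  ...     | inj₂ (rep-t→t , _) = off (t , subst (λ z → E D z t ≡ true) (sym w≡rep-t) rep-t→t , inNbr-edge in-u≡t)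
  rep-u↛w e | inj₂ (rep-u→u , τrep) =
    u≢w (just-injective (trans (sym (outNbr-unique τrep rep-u→u)) (proj₁ (conflict-B τrep e))))

  larger-cut : ∃[ X ] (edges D < 3 * cutSize D X)
  larger-cut with merged-colouring conflict conflict-fixpoint-free (rep u) w rep-u↛w w↛rep-u
  ... | h , proper , same =
    best-cut D parts (suc (edges D)) (covered-twice⇒ covered u w uw (covered-twice u w τu τw colour-u≡colour-w))
    where
    open ThreeCuts h proper
    colour-u≡colour-w : colour u ≡ colour w
    colour-u≡colour-w = trans same (cong h (sym (rep-B {w} τw)))

-- D − v: all edges at v removed (the vertex set is kept).
delete : (D : Digraph) → Fin (n D) → Digraph
delete D v = record
  { n        = n D
  ; E        = λ x y → E D x y ∧ not (x == v) ∧ not (y == v)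
  ; loopless = λ a → cong (λ b → b ∧ not (a == v) ∧ not (a == v)) (loopless D a)
  }

delete-sub : ∀ D v {x y} → E (delete D v) x y ≡ true → E D x y ≡ true
delete-sub D v {x} = ∧-conicalˡ (E D x _) _

delete-away : ∀ D v {x y} → x ≢ v → y ≢ v → E (delete D v) x y ≡ E D x y
delete-away D v {x} {y} x≢v y≢v =
  trans (cong₂ (λ a b → E D x y ∧ not a ∧ not b) (dec-false (x Fin.≟ v) x≢v) (dec-false (y Fin.≟ v) y≢v))
        (∧-identityʳ (E D x y))

delete-InD₁₁ : ∀ D v → InD₁₁ D → InD₁₁ (delete D v)
delete-InD₁₁ D v D11 w with D11 w
... | inj₁ in≤1  = inj₁ (≤-trans (count-mono λ x → delete-sub D v {x} {w}) in≤1)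
... | inj₂ out≤1 = inj₂ (≤-trans (count-mono λ y → delete-sub D v {w} {y}) out≤1)

good bad : (D : Digraph) → Fin (n D) → Fin (n D) → Bool
good D v w = E D v w ∧ does (d⁺ (delete D v) w ≤? 1)
bad  D v w = E D v w ∧ not (does (d⁺ (delete D v) w ≤? 1))

-- The weight of an edge leaving a vertex that lies in all three partitions.
fullWeight : Bool → Colour → ℕ
fullWeight τy cy = count (λ i → not (inPart τy cy i))

fullWeight-A : ∀ c → 1 ≤ fullWeight true c
fullWeight-A c = count-≥1 (λ i → not (not (c == i))) {c} (cong (λ b → not (not b)) (==-refl c))

fullWeight-B : ∀ c → 2 ≤ fullWeight false c
fullWeight-B zero             = s≤s (s≤s z≤n)
fullWeight-B (suc zero)       = s≤s (s≤s z≤n)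
fullWeight-B (suc (suc zero)) = s≤s (s≤s z≤n)

fullWeight≥1 : ∀ τy c → 1 ≤ fullWeight τy c
fullWeight≥1 true  c = fullWeight-A c
fullWeight≥1 false c = ≤-trans (s≤s z≤n) (fullWeight-B c)

-- A vertex v with more "good" out-neighbours w (those with d⁺ w ≤ 1 in D − v)
-- than in-neighbours gives a cut of size > m/3.  Cover D − v by three cuts,
-- typing the good vertices as B, and put v into all three parts.  Edges of
-- D − v stay covered, edges into v are lost, and edges from v are covered once,
-- twice when they end in a good vertex; the total thus gains
-- #good − d⁻ v > 0 over the number of edges.
module HeavyVertex (D : Digraph) (D11 : InD₁₁ D) (v : Fin (n D)) where

  D′ : Digraph
  D′ = delete D v

  τ : Fin (n D) → Bool
  τ w = if good D v w then false else defaultType D′ w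

  typing : Typing D′ τ
  typing w with good D v w in good-w
  ... | true  = (λ ()) , λ _ → does-true (d⁺ D′ w ≤? 1) (∧-conicalʳ (E D v w) _ good-w)
  ... | false = defaultTyping D′ (delete-InD₁₁ D v D11) w

  open Constraints D′ τ typing using (colouring; module ThreeCuts)
  open ThreeCuts (proj₁ colouring) (proj₂ colouring) using (colour; covered) renaming (parts to parts′; cutWeight to cutWeight′)

  parts⁺ : Fin 3 → Fin (n D) → Bool
  parts⁺ i x = (x == v) ∨ parts′ i x

  open CutFamily D parts⁺ using (cutWeight; totalCut; totalCut≡)

  parts⁺-away : ∀ i {x} → x ≢ v → parts⁺ i x ≡ parts′ i x
  parts⁺-away i {x} x≢v = cong (_∨ parts′ i x) (dec-false (x Fin.≟ v) x≢v)

  parts⁺-v : ∀ i → parts⁺ i v ≡ true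
  parts⁺-v i = cong (_∨ parts′ i v) (==-refl v)

  weight-away : ∀ {x y} → x ≢ v → y ≢ v → cutWeight x y ≡ cutWeight′ x y
  weight-away x≢v y≢v = sum-cong-≗ λ i → cong₂ (λ a b → b2n (a ∧ not b)) (parts⁺-away i x≢v) (parts⁺-away i y≢v)

  weight-from-v : ∀ {y} → y ≢ v → cutWeight v y ≡ fullWeight (τ y) (colour y)
  weight-from-v y≢v = sum-cong-≗ λ i → cong₂ (λ a b → b2n (a ∧ not b)) (parts⁺-v i) (parts⁺-away i y≢v)

  kept : ∀ {x y} → x ≢ v → y ≢ v → b2n (E D x y) ≤ mask (E D x y) (cutWeight x y)
  kept {x} {y} x≢v y≢v with E D x y in Exy
  ... | false = z≤n
  ... | true  = subst (1 ≤_) (sym (weight-away {x} {y} x≢v y≢v)) (covered x y (trans (delete-away D v x≢v y≢v) Exy))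

  from-v : ∀ {y} → y ≢ v → b2n (E D v y) + b2n (good D v y) ≤ mask (E D v y) (cutWeight v y)
  from-v {y} y≢v = by-cases (E D v y) (good D v y) refl refl
    where
    W : ℕ
    W = cutWeight v y
    by-cases : ∀ e g → E D v y ≡ e → good D v y ≡ g → b2n (E D v y) + b2n (good D v y) ≤ mask (E D v y) W
    by-cases _ true Evy good-y =
      subst₂ (λ e g → b2n e + b2n g ≤ mask e W) (sym (∧-conicalˡ (E D v y) _ good-y)) (sym good-y)
        (subst (2 ≤_) (sym (weight-from-v {y} y≢v))
          (subst (λ t → 2 ≤ fullWeight t (colour y)) (cong (λ b → if b then false else defaultType D′ y) (sym good-y))
            (fullWeight-B (colour y))))
    by-cases false false Evy good-y = subst₂ (λ e g → b2n e + b2n g ≤ mask e W) (sym Evy) (sym good-y) z≤n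
    by-cases true  false Evy good-y = subst₂ (λ e g → b2n e + b2n g ≤ mask e W) (sym Evy) (sym good-y)
                                        (subst (1 ≤_) (sym (weight-from-v {y} y≢v)) (fullWeight≥1 (τ y) (colour y)))

  -- Edge by edge, the gain at good out-neighbours of v is paid for by the
  -- cut weights together with the edges entering v.
  edge-bound : ∀ x y → b2n (E D x y) + b2n ((x == v) ∧ good D v y) ≤ mask (E D x y) (cutWeight x y) + b2n (E D x v ∧ (y == v))
  edge-bound x y = by-position (x Fin.≟ v) (y Fin.≟ v)
    where
    Bound : Bool → Bool → Set
    Bound a b = b2n (E D x y) + b2n (a ∧ good D v y) ≤ mask (E D x y) (cutWeight x y) + b2n (E D x v ∧ b)
    by-position : (x≟v : Dec (x ≡ v)) (y≟v : Dec (y ≡ v)) → Bound (does x≟v) (does y≟v)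
    by-position (yes refl) (yes refl) =
      ≤-trans (≤-reflexive (cong₂ _+_ (cong b2n (loopless D x)) (cong (λ e → b2n (e ∧ does (d⁺ D′ x ≤? 1))) (loopless D x)))) z≤n
    by-position (yes refl) (no y≢v) = ≤-trans (from-v y≢v) (m≤m+n _ _)
    by-position (no x≢v) (yes refl) =
      ≤-trans (≤-reflexive (trans (+-identityʳ _) (cong b2n (sym (∧-identityʳ (E D x y)))))) (m≤n+m _ _)
    by-position (no x≢v) (no y≢v) = ≤-trans (≤-reflexive (+-identityʳ _)) (≤-trans (kept x≢v y≢v) (m≤m+n _ _))

  edges+good≤ : edges D + count (good D v) ≤ totalCut + d⁻ D v
  edges+good≤ = begin
    edges D + count (good D v)                                                 ≡⟨ lhs ⟨
    ∑ (λ x → ∑ (λ y → b2n (E D x y) + b2n ((x == v) ∧ good D v y)))            ≤⟨ ∑-mono (λ x → ∑-mono (edge-bound x)) ⟩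
    ∑ (λ x → ∑ (λ y → mask (E D x y) (cutWeight x y) + b2n (E D x v ∧ (y == v)))) ≡⟨ rhs ⟩
    totalCut + d⁻ D v                                                          ∎
    where
    open ≤-Reasoning
    lhs : ∑ (λ x → ∑ (λ y → b2n (E D x y) + b2n ((x == v) ∧ good D v y))) ≡ edges D + count (good D v)
    lhs = trans (∑∑-+ (λ x y → b2n (E D x y)) (λ x y → b2n ((x == v) ∧ good D v y)))
                (cong₂ _+_ (sym (edges≡ D)) (trans (sum-cong-≗ λ x → sym (mask-count (x == v) (good D v))) (∑-at v (λ _ → count (good D v)))))
    rhs : ∑ (λ x → ∑ (λ y → mask (E D x y) (cutWeight x y) + b2n (E D x v ∧ (y == v)))) ≡ totalCut + d⁻ D v
    rhs = trans (∑∑-+ (λ x y → mask (E D x y) (cutWeight x y)) (λ x y → b2n (E D x v ∧ (y == v))))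
                (cong₂ _+_ (sym totalCut≡) (sum-cong-≗ λ x → count-at (λ _ → E D x v) v))

  larger-cut : d⁻ D v < count (good D v) → ∃[ X ] (edges D < 3 * cutSize D X)
  larger-cut heavy = best-cut D parts⁺ (suc (edges D)) (+-cancelʳ-≤ (d⁻ D v) (suc (edges D)) totalCut (begin
    suc (edges D) + d⁻ D v       ≡⟨ +-suc (edges D) (d⁻ D v) ⟨
    edges D + suc (d⁻ D v)       ≤⟨ +-monoʳ-≤ (edges D) heavy ⟩
    edges D + count (good D v)   ≤⟨ edges+good≤ ⟩
    totalCut + d⁻ D v            ∎))
    where open ≤-Reasoning

delete-out≤ : ∀ D v g → d⁺ (delete D v) g ≤ d⁺ D g
delete-out≤ D v g = count-mono λ y → delete-sub D v {g} {y}

delete-out-kept : ∀ D v {g} → g ≢ v → E D g v ≡ false → d⁺ D g ≤ d⁺ (delete D v) g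
delete-out-kept D v {g} g≢v g↛v = count-mono λ y g→y → trans (delete-away D v g≢v (y≢v y g→y)) g→y
  where
  y≢v : ∀ y → E D g y ≡ true → y ≢ v
  y≢v y g→y refl = true≢false g→y g↛v

in-unique : ∀ D {a b w} → d⁻ D w ≤ 1 → E D a w ≡ true → E D b w ≡ true → a ≡ b
in-unique D {w = w} in≤1 = count≤1-unique (λ x → E D x w) in≤1

-- Every edge has one tail and one head.
∑out≡∑in : ∀ D → ∑ (d⁺ D) ≡ ∑ (d⁻ D)
∑out≡∑in D = ∑-comm (λ x y → b2n (E D x y))

good⇒edge : ∀ D {v w} → good D v w ≡ true → E D v w ≡ true
good⇒edge D {v} {w} = ∧-conicalˡ (E D v w) _

bad⇒edge : ∀ D {v w} → bad D v w ≡ true → E D v w ≡ true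
bad⇒edge D {v} {w} = ∧-conicalˡ (E D v w) _

surplus : (D : Digraph) → Fin (n D) → Bool
surplus D v = does (suc (d⁻ D v) ≤? d⁺ D v)

-- A bad edge v → w forces d⁺ w ≥ 2, hence d⁻ w ≤ 1 and surplus at w; a vertex
-- with surplus has a bad out-neighbour.  Double counting bad edges, each vertex
-- with surplus has exactly one bad out-neighbour and exactly one bad
-- in-neighbour; following the triangle through a good out-neighbour then
-- leads to a contradiction.
module NoSurplus (D : Digraph) (D11 : InD₁₁ D)
                 (on-triangle : ∀ u w → E D u w ≡ true → d⁻ D u ≤ 1 → d⁺ D w ≤ 1 → OnTriangle D u w)
                 (few-good : ∀ v → count (good D v) ≤ d⁻ D v) where

  -- Surplus forces d⁻ v ≤ 1 (as d⁺ v ≤ 1 would leave no room).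
  surplus-in : ∀ v → surplus D v ≡ true → d⁻ D v ≤ 1
  surplus-in v s with D11 v
  ... | inj₁ in≤1  = in≤1
  ... | inj₂ out≤1 = ≤-trans (≤-pred (≤-trans (does-true (_ ≤? _) s) out≤1)) z≤n

  -- The head of a bad edge has d⁺ ≥ 2, hence d⁻ ≤ 1, hence surplus.
  bad-out : ∀ v w → bad D v w ≡ true → 2 ≤ d⁺ D w
  bad-out v w b = ≤-trans (≰⇒> (does-false (_ ≤? 1) (not-injective (∧-conicalʳ (E D v w) _ b)))) (delete-out≤ D v w)

  bad-in : ∀ v w → bad D v w ≡ true → d⁻ D w ≤ 1
  bad-in v w b with D11 w
  ... | inj₁ in≤1  = in≤1
  ... | inj₂ out≤1 = contradiction out≤1 (<⇒≱ (bad-out v w b))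

  bad⇒surplus : ∀ v w → bad D v w ≡ true → surplus D w ≡ true
  bad⇒surplus v w b = dec-true (_ ≤? _) (≤-trans (s≤s (bad-in v w b)) (bad-out v w b))

  badOut badIn : Fin (n D) → ℕ
  badOut v = count (bad D v)
  badIn  w = count (λ v → bad D v w)

  -- Surplus at v needs a bad out-neighbour, since v has at most d⁻ v good ones.
  surplus≤badOut : ∀ v → b2n (surplus D v) ≤ badOut v
  surplus≤badOut v with surplus D v in s
  ... | false = z≤n
  ... | true  = +-cancelˡ-≤ (d⁻ D v) 1 (badOut v) (begin
    d⁻ D v + 1                          ≡⟨ +-comm (d⁻ D v) 1 ⟩
    suc (d⁻ D v)                        ≤⟨ does-true (_ ≤? _) s ⟩
    d⁺ D v                              ≡⟨ count-split (E D v) (λ w → does (d⁺ (delete D v) w ≤? 1)) ⟩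
    count (good D v) + badOut v         ≤⟨ +-monoˡ-≤ (badOut v) (few-good v) ⟩
    d⁻ D v + badOut v                   ∎)
    where open ≤-Reasoning

  -- A head of bad edges has surplus and at most one in-neighbour.
  badIn≤surplus : ∀ w → badIn w ≤ b2n (surplus D w)
  badIn≤surplus w = ≤-trans (count-mono λ v b → cong₂ _∧_ (∧-conicalˡ (E D v w) _ b) (bad⇒surplus v w b))
                            (by-surplus (surplus D w) refl)
    where
    by-surplus : ∀ s → surplus D w ≡ s → count (λ v → E D v w ∧ surplus D w) ≤ b2n s
    by-surplus true  s = subst (_≤ 1) (sym (sum-cong-≗ λ v → cong b2n (trans (cong (E D v w ∧_) s) (∧-identityʳ (E D v w)))))
                               (surplus-in w s)
    by-surplus false s = ≤-reflexive (count-none (λ v → E D v w ∧ surplus D w) λ v → trans (cong (E D v w ∧_) s) (∧-zeroʳ (E D v w)))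

  -- Double counting the bad edges makes both inequalities equalities.
  ∑badOut≡∑badIn : ∑ badOut ≡ ∑ badIn
  ∑badOut≡∑badIn = ∑-comm (λ v w → b2n (bad D v w))

  badOut≡surplus : ∀ v → b2n (surplus D v) ≡ badOut v
  badOut≡surplus = ∑-rigid surplus≤badOut (≤-trans (≤-reflexive ∑badOut≡∑badIn) (∑-mono badIn≤surplus))

  badIn≡surplus : ∀ w → badIn w ≡ b2n (surplus D w)
  badIn≡surplus = ∑-rigid badIn≤surplus (≤-trans (∑-mono surplus≤badOut) (≤-reflexive ∑badOut≡∑badIn))

  bad⇒surplus-source : ∀ v w → bad D v w ≡ true → surplus D v ≡ true
  bad⇒surplus-source v w b with surplus D v in s
  ... | true  = refl
  ... | false = contradiction (subst (1 ≤_) (sym (trans (cong b2n (sym s)) (badOut≡surplus v))) (count-≥1 (bad D v) b)) λ ()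

  surplus⇒bad-in-nbr : ∀ w → surplus D w ≡ true → ∃[ v ] (bad D v w ≡ true)
  surplus⇒bad-in-nbr w s = count-pos (λ v → bad D v w) (≤-reflexive (sym (trans (badIn≡surplus w) (cong b2n s))))

  -- If d⁺ g ≤ 1, the triangle through vg returns to v via
  -- its unique in-neighbour x, so g → x; then g is the bad in-neighbour of x,
  -- so g has surplus: d⁺ g > d⁻ g ≥ 1, contradicting d⁺ g ≤ 1.
  bad-in-good-out-light : ∀ {v x g} → surplus D v ≡ true → bad D x v ≡ true → good D v g ≡ true → d⁺ D g ≤ 1 → ⊥
  bad-in-good-out-light {v} {x} {g} sv bxv gvg out-g≤1 with on-triangle v g (good⇒edge D gvg) (surplus-in v sv) out-g≤1
  ... | y , g→y , y→v with in-unique D (surplus-in v sv) y→v (bad⇒edge D bxv)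
  ... | refl with surplus⇒bad-in-nbr y (bad⇒surplus-source y v bxv)
  ... | z , bzy with in-unique D (surplus-in y (bad⇒surplus-source y v bxv)) (bad⇒edge D bzy) g→y
  ... | refl = contradiction (≤-trans (s≤s (count-≥1 (λ t → E D t z) (good⇒edge D gvg)))
                                      (≤-trans (does-true (_ ≤? _) (bad⇒surplus-source z y bzy)) out-g≤1))
                             λ { (s≤s ()) }

  -- If d⁺ g ≥ 2, then g loses an out-edge in D − v, so g → v and g = x;
  -- the bad in-neighbour of x = g is then v itself, but v → g is good.
  bad-in-good-out-heavy : ∀ {v x g} → surplus D v ≡ true → bad D x v ≡ true → good D v g ≡ true → ¬ d⁺ D g ≤ 1 → ⊥
  bad-in-good-out-heavy {v} {x} {g} sv bxv gvg out-g≰1 with E D g v in g→v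
  ... | false = out-g≰1 (≤-trans (delete-out-kept D v g≢v g→v) (does-true (_ ≤? 1) (∧-conicalʳ (E D v g) _ gvg)))
    where
    g≢v : g ≢ v
    g≢v = no-loop D (good⇒edge D gvg) ∘ sym
  ... | true with in-unique D (surplus-in v sv) g→v (bad⇒edge D bxv)
  ... | refl with surplus⇒bad-in-nbr g (bad⇒surplus-source g v bxv)
  ... | z , bzg with in-unique D (surplus-in g (bad⇒surplus-source g v bxv)) (bad⇒edge D bzg) (good⇒edge D gvg)
  ... | refl = true≢false (∧-conicalʳ (E D z g) _ gvg) (not-injective (∧-conicalʳ (E D z g) _ bzg))

  -- A vertex with surplus has a bad in-neighbour and a good out-neighbour.
  no-surplus : ∀ v → surplus D v ≡ false
  no-surplus v with surplus D v in sv
  ... | false = refl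
  ... | true with surplus⇒bad-in-nbr v sv
  ... | x , bxv with count-pos (good D v) some-good
    where
    -- d⁻ v + 1 ≤ d⁺ v = #good + #bad = #good + 1, and d⁻ v ≥ 1 because of x.
    some-good : 1 ≤ count (good D v)
    some-good = ≤-trans (count-≥1 (λ y → E D y v) (bad⇒edge D bxv)) (≤-pred (begin
      suc (d⁻ D v)                  ≤⟨ does-true (_ ≤? _) sv ⟩
      d⁺ D v                        ≡⟨ count-split (E D v) (λ w → does (d⁺ (delete D v) w ≤? 1)) ⟩
      count (good D v) + badOut v   ≡⟨ cong (count (good D v) +_) (sym (trans (cong b2n (sym sv)) (badOut≡surplus v))) ⟩
      count (good D v) + 1          ≡⟨ +-comm _ 1 ⟩
      suc (count (good D v))        ∎))
      where open ≤-Reasoning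
  ... | g , gvg with d⁺ D g ≤? 1
  ...   | yes out-g≤1 = ⊥-elim (bad-in-good-out-light sv bxv gvg out-g≤1)
  ...   | no  out-g≰1 = ⊥-elim (bad-in-good-out-heavy sv bxv gvg out-g≰1)

concatMap'-++ : ∀ {A B : Set} (f : A → List B) xs ys → concatMap' f (xs ++ ys) ≡ concatMap' f xs ++ concatMap' f ys
concatMap'-++ f []       ys = refl
concatMap'-++ f (x ∷ xs) ys = trans (cong (f x ++_) (concatMap'-++ f xs ys)) (sym (++-assoc (f x) _ _))

∈-concatMap'⁺ : ∀ {A B : Set} (f : A → List B) {xs u z} → u ∈ xs → z ∈ f u → z ∈ concatMap' f xs
∈-concatMap'⁺ f {x ∷ xs} (here refl) z∈fu = ∈-++⁺ˡ z∈fu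
∈-concatMap'⁺ f {x ∷ xs} (there u∈xs) z∈fu = ∈-++⁺ʳ (f x) (∈-concatMap'⁺ f u∈xs z∈fu)

∈-concatMap'⁻ : ∀ {A B : Set} (f : A → List B) xs {z} → z ∈ concatMap' f xs → ∃[ u ] (u ∈ xs × z ∈ f u)
∈-concatMap'⁻ f (x ∷ xs) z∈ with ∈-++⁻ (f x) z∈
... | inj₁ z∈fx = x , here refl , z∈fx
... | inj₂ z∈rest with ∈-concatMap'⁻ f xs z∈rest
...   | u , u∈xs , z∈fu = u , there u∈xs , z∈fu

-- Each
-- edge u → w continues as w → next w → u, so next permutes the vertices on
-- edges in 3-cycles; list each cycle once, starting from its least vertex.
module TriangleDecomposition (D : Digraph) (out≤1 : ∀ v → d⁺ D v ≤ 1)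
                             (on-triangle : ∀ u w → E D u w ≡ true → OnTriangle D u w) where

  V : Set
  V = Fin (n D)

  -- The out-neighbour of v (v itself when there is none).
  next : V → V
  next v with choose (E D v)
  ... | just w  = w
  ... | nothing = v

  next-edge : ∀ {u w} → E D u w ≡ true → next u ≡ w
  next-edge {u} {w} e with choose (E D u) | choose-unique (E D u) (out≤1 u) e
  ... | just .w | refl = refl

  edge₂ : ∀ {u} → E D u (next u) ≡ true → E D (next u) (next (next u)) ≡ true
  edge₂ {u} e with on-triangle u (next u) e
  ... | x , e₂ , _ = subst (λ z → E D (next u) z ≡ true) (sym (next-edge e₂)) e₂

  edge₃ : ∀ {u} → E D u (next u) ≡ true → E D (next (next u)) u ≡ true
  edge₃ {u} e with on-triangle u (next u) e
  ... | x , e₂ , e₃ = subst (λ z → E D z u ≡ true) (sym (next-edge e₂)) e₃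

  next³ : ∀ {u} → E D u (next u) ≡ true → next (next (next u)) ≡ u
  next³ e = next-edge (edge₃ e)

  leader : V → Bool
  leader u = E D u (next u) ∧ does (u Fin.<? next u) ∧ does (u Fin.<? next (next u))

  record Leader (u : V) : Set where
    field
      edge : E D u (next u) ≡ true
      <₁   : u <ᶠ next u
      <₂   : u <ᶠ next (next u)

  leader⇒ : ∀ {u} → leader u ≡ true → Leader u
  leader⇒ {u} l = record
    { edge = ∧-conicalˡ (E D u (next u)) _ l
    ; <₁   = does-true (u Fin.<? next u) (∧-conicalˡ _ _ rest)
    ; <₂   = does-true (u Fin.<? next (next u)) (∧-conicalʳ _ _ rest)
    }
    where
    rest : does (u Fin.<? next u) ∧ does (u Fin.<? next (next u)) ≡ true
    rest = ∧-conicalʳ (E D u (next u)) _ l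

  ⇒leader : ∀ {u} → E D u (next u) ≡ true → u <ᶠ next u → u <ᶠ next (next u) → leader u ≡ true
  ⇒leader {u} e l₁ l₂ = cong₂ _∧_ e (cong₂ _∧_ (dec-true (u Fin.<? next u) l₁) (dec-true (u Fin.<? next (next u)) l₂))

  triangleAt : V → List (V × V × V)
  triangleAt u = if leader u then (u , next u , next (next u)) ∷ [] else []

  verticesAt : V → List V
  verticesAt u = if leader u then u ∷ next u ∷ next (next u) ∷ [] else []

  edgesAt : V → List (V × V)
  edgesAt u = if leader u then (u , next u) ∷ (next u , next (next u)) ∷ (next (next u) , u) ∷ [] else []

  triangles : List (V × V × V)
  triangles = concatMap' triangleAt (allFin (n D))

  triangle-vertices≡ : ∀ L → concatMap' triVerts (concatMap' triangleAt L) ≡ concatMap' verticesAt L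
  triangle-vertices≡ []      = refl
  triangle-vertices≡ (u ∷ L) = trans (concatMap'-++ triVerts (triangleAt u) _)
                            (cong₂ _++_ (at (leader u)) (triangle-vertices≡ L))
    where
    at : ∀ b → concatMap' triVerts (if b then (u , next u , next (next u)) ∷ [] else [])
               ≡ (if b then u ∷ next u ∷ next (next u) ∷ [] else [])
    at true  = refl
    at false = refl

  triangle-edges≡ : ∀ L → concatMap' triEdges (concatMap' triangleAt L) ≡ concatMap' edgesAt L
  triangle-edges≡ []      = refl
  triangle-edges≡ (u ∷ L) = trans (concatMap'-++ triEdges (triangleAt u) _)
                          (cong₂ _++_ (at (leader u)) (triangle-edges≡ L))
    where
    at : ∀ b → concatMap' triEdges (if b then (u , next u , next (next u)) ∷ [] else [])
               ≡ (if b then (u , next u) ∷ (next u , next (next u)) ∷ (next (next u) , u) ∷ [] else [])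
    at true  = refl
    at false = refl

  OnTriangleOf : V → V → Set
  OnTriangleOf u z = z ≡ u ⊎ (z ≡ next u ⊎ z ≡ next (next u))

  ∈verticesAt : ∀ {u z} → z ∈ verticesAt u → Leader u × OnTriangleOf u z
  ∈verticesAt {u} {z} z∈ = by-leader (leader u) refl
    where
    by-leader : ∀ b → leader u ≡ b → Leader u × OnTriangleOf u z
    by-leader true l with subst (λ b → z ∈ (if b then u ∷ next u ∷ next (next u) ∷ [] else [])) l z∈
    ... | here z≡u                 = leader⇒ l , inj₁ z≡u
    ... | there (here z≡nu)        = leader⇒ l , inj₂ (inj₁ z≡nu)
    ... | there (there (here z≡nnu)) = leader⇒ l , inj₂ (inj₂ z≡nnu)
    by-leader false l with subst (λ b → z ∈ (if b then u ∷ next u ∷ next (next u) ∷ [] else [])) l z∈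
    ... | ()

  not-consecutive : ∀ {u u'} → Leader u → Leader u' → u' ≡ next u → ⊥
  not-consecutive {u} lu lu' refl =
    Fin.<-asym (Leader.<₁ lu) (subst (next u <ᶠ_) (next³ (Leader.edge lu)) (Leader.<₂ lu'))

  leader-from : ∀ {u z} → Leader u → OnTriangleOf u z → u ≡ z ⊎ (u ≡ next z ⊎ u ≡ next (next z))
  leader-from lu (inj₁ refl)        = inj₁ refl
  leader-from lu (inj₂ (inj₁ refl)) = inj₂ (inj₂ (sym (next³ (Leader.edge lu))))
  leader-from lu (inj₂ (inj₂ refl)) = inj₂ (inj₁ (sym (next³ (Leader.edge lu))))

  same-leader : ∀ {u u' z} → Leader u → Leader u' → OnTriangleOf u z → OnTriangleOf u' z → u ≡ u'
  same-leader lu lu' z∈u z∈u' with leader-from lu z∈u | leader-from lu' z∈u'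
  ... | inj₁ refl        | inj₁ refl        = refl
  ... | inj₁ refl        | inj₂ (inj₁ refl) = ⊥-elim (not-consecutive lu lu' refl)
  ... | inj₁ refl        | inj₂ (inj₂ refl) = ⊥-elim (not-consecutive lu' lu (sym (next³ (Leader.edge lu))))
  ... | inj₂ (inj₁ refl) | inj₁ refl        = ⊥-elim (not-consecutive lu' lu refl)
  ... | inj₂ (inj₁ refl) | inj₂ (inj₁ refl) = refl
  ... | inj₂ (inj₁ refl) | inj₂ (inj₂ refl) = ⊥-elim (not-consecutive lu lu' refl)
  ... | inj₂ (inj₂ refl) | inj₁ refl        = ⊥-elim (not-consecutive lu lu' (sym (next³ (Leader.edge lu'))))
  ... | inj₂ (inj₂ refl) | inj₂ (inj₁ refl) = ⊥-elim (not-consecutive lu' lu refl)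
  ... | inj₂ (inj₂ refl) | inj₂ (inj₂ refl) = refl

  -- Different leaders have disjoint triangles, so listing the triangles of
  -- distinct vertices lists every vertex at most once.
  unique-vertices : ∀ L → Unique L → Unique (concatMap' verticesAt L)
  unique-vertices []      _             = []
  unique-vertices (u ∷ L) (u∉L ∷ uniq) = Unique.++⁺ (unique-at (leader u) refl) (unique-vertices L uniq) disjoint
    where
    unique-at : ∀ b → leader u ≡ b → Unique (if b then u ∷ next u ∷ next (next u) ∷ [] else [])
    unique-at false _ = []
    unique-at true  l = (no-loop D e ∷ (λ u≡nnu → no-loop D (edge₃ e) (sym u≡nnu)) ∷ [])
                      ∷ (no-loop D (edge₂ e) ∷ []) ∷ [] ∷ []
      where
      e : E D u (next u) ≡ true
      e = Leader.edge (leader⇒ l)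
    disjoint : ∀ {z} → ¬ (z ∈ verticesAt u × z ∈ concatMap' verticesAt L)
    disjoint (z∈u , z∈L) with ∈-concatMap'⁻ verticesAt L z∈L
    ... | u' , u'∈L , z∈u' with ∈verticesAt z∈u | ∈verticesAt z∈u'
    ...   | lu , on-u | lu' , on-u' = lookup u∉L u'∈L (same-leader lu lu' on-u on-u')

  -- Every edge is an edge of the triangle led by the least vertex on it.
  edge⇒listed : ∀ x y → E D x y ≡ true → (x , y) ∈ concatMap' edgesAt (allFin (n D))
  edge⇒listed x y x→y = subst (λ w → (x , w) ∈ concatMap' edgesAt (allFin (n D))) (next-edge x→y) edge-listed
    where
    e₁ : E D x (next x) ≡ true
    e₁ = subst (λ w → E D x w ≡ true) (sym (next-edge x→y)) x→y
    x³ : next (next (next x)) ≡ x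
    x³ = next³ e₁
    in-triangle-of : ∀ a → leader a ≡ true →
                     (x , next x) ∈ ((a , next a) ∷ (next a , next (next a)) ∷ (next (next a) , a) ∷ []) →
                     (x , next x) ∈ concatMap' edgesAt (allFin (n D))
    in-triangle-of a l x∈ = ∈-concatMap'⁺ edgesAt (∈-allFin a)
      (subst (λ b → (x , next x) ∈ (if b then (a , next a) ∷ (next a , next (next a)) ∷ (next (next a) , a) ∷ [] else [])) (sym l) x∈)
    led-by-x : x <ᶠ next x → x <ᶠ next (next x) → (x , next x) ∈ concatMap' edgesAt (allFin (n D))
    led-by-x l₁ l₂ = in-triangle-of x (⇒leader e₁ l₁ l₂) (here refl)
    led-by-next : next x <ᶠ next (next x) → next x <ᶠ x → (x , next x) ∈ concatMap' edgesAt (allFin (n D))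
    led-by-next l₁ l₂ = in-triangle-of (next x) (⇒leader (edge₂ e₁) l₁ (subst (next x <ᶠ_) (sym x³) l₂))
                          (there (there (here (cong₂ _,_ (sym x³) refl))))
    led-by-next² : next (next x) <ᶠ x → next (next x) <ᶠ next x → (x , next x) ∈ concatMap' edgesAt (allFin (n D))
    led-by-next² l₁ l₂ = in-triangle-of (next (next x))
                           (⇒leader (subst (λ w → E D (next (next x)) w ≡ true) (sym x³) (edge₃ e₁))
                                    (subst (next (next x) <ᶠ_) (sym x³) l₁) (subst (next (next x) <ᶠ_) (sym (cong next x³)) l₂))
                           (there (here (cong₂ _,_ (sym x³) (sym (cong next x³)))))
    edge-listed : (x , next x) ∈ concatMap' edgesAt (allFin (n D))
    edge-listed with Fin.<-cmp x (next x) | Fin.<-cmp x (next (next x)) | Fin.<-cmp (next x) (next (next x))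
    ... | tri≈ _ eq _ | _           | _           = ⊥-elim (no-loop D e₁ eq)
    ... | _           | tri≈ _ eq _ | _           = ⊥-elim (no-loop D (edge₃ e₁) (sym eq))
    ... | _           | _           | tri≈ _ eq _ = ⊥-elim (no-loop D (edge₂ e₁) eq)
    ... | tri< a _ _  | tri< b _ _  | _           = led-by-x a b
    ... | tri> _ _ a  | _           | tri< b _ _  = led-by-next b a
    ... | _           | tri> _ _ a  | tri> _ _ b  = led-by-next² a b
    ... | tri< a _ _  | tri> _ _ b  | tri< c _ _  = ⊥-elim (Fin.<-asym (Fin.<-trans a c) b)
    ... | tri> _ _ a  | tri< b _ _  | tri> _ _ c  = ⊥-elim (Fin.<-asym (Fin.<-trans c a) b)

  listed⇒edge : ∀ x y → (x , y) ∈ concatMap' edgesAt (allFin (n D)) → E D x y ≡ true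
  listed⇒edge x y xy∈ with ∈-concatMap'⁻ edgesAt (allFin (n D)) xy∈
  ... | u , _ , xy∈u = by-leader (leader u) refl
    where
    by-leader : ∀ b → leader u ≡ b → E D x y ≡ true
    by-leader true l with subst (λ b → (x , y) ∈ (if b then (u , next u) ∷ (next u , next (next u)) ∷ (next (next u) , u) ∷ [] else [])) l xy∈u
    ... | here refl                 = Leader.edge (leader⇒ l)
    ... | there (here refl)         = edge₂ (Leader.edge (leader⇒ l))
    ... | there (there (here refl)) = edge₃ (Leader.edge (leader⇒ l))
    by-leader false l with subst (λ b → (x , y) ∈ (if b then (u , next u) ∷ (next u , next (next u)) ∷ (next (next u) , u) ∷ [] else [])) l xy∈u
    ... | ()

  decomposition : UnionOfDisjointTriangles D
  decomposition = triangles
                , subst Unique (sym (triangle-vertices≡ (allFin (n D)))) (unique-vertices (allFin (n D)) (Unique.allFin⁺ (n D)))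
                , λ x y → mk⇔ (λ e → subst ((x , y) ∈_) (sym (triangle-edges≡ (allFin (n D)))) (edge⇒listed x y e))
                              (λ m → listed⇒edge x y (subst ((x , y) ∈_) (triangle-edges≡ (allFin (n D))) m))

-- The converse: in a union of vertex-disjoint triangles every cut meets each
-- triangle in at most one edge, so it has at most m/3 edges.

listed : ∀ {k} → List (Fin k × Fin k) → Fin k → Fin k → Bool
listed []            x y = false
listed ((a , b) ∷ L) x y = ((x == a) ∧ (y == b)) ∨ listed L x y

listed⇒∈ : ∀ {k} (L : List (Fin k × Fin k)) x y → listed L x y ≡ true → (x , y) ∈ L
listed⇒∈ ((a , b) ∷ L) x y e with ∨-true ((x == a) ∧ (y == b)) e
... | inj₁ here′ = here (cong₂ _,_ (does-true (x Fin.≟ a) (∧-conicalˡ _ _ here′)) (does-true (y Fin.≟ b) (∧-conicalʳ _ _ here′)))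
... | inj₂ later = there (listed⇒∈ L x y later)

∈⇒listed : ∀ {k} (L : List (Fin k × Fin k)) x y → (x , y) ∈ L → listed L x y ≡ true
∈⇒listed ((a , b) ∷ L) x y (here refl)  = cong (_∨ listed L x y) (cong₂ _∧_ (==-refl x) (==-refl y))
∈⇒listed ((a , b) ∷ L) x y (there x,y∈) = ∨-introʳ ((x == a) ∧ (y == b)) (∈⇒listed L x y x,y∈)

sumOver : ∀ {k} → (Fin k → Fin k → ℕ) → List (Fin k × Fin k) → ℕ
sumOver F []            = 0
sumOver F ((a , b) ∷ L) = F a b + sumOver F L

∑-mask-out : ∀ {k} c (f : Fin k → ℕ) → ∑ (λ i → mask c (f i)) ≡ mask c (∑ f)
∑-mask-out true  f = refl
∑-mask-out false f = ∑-zero {f = λ i → mask false (f i)} λ _ → refl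

∑∑-listed : ∀ {k} (F : Fin k → Fin k → ℕ) L → Unique L →
            ∑ (λ x → ∑ (λ y → mask (listed L x y) (F x y))) ≡ sumOver F L
∑∑-listed {k} F []            _             = ∑-zero {k} λ x → ∑-zero {k} λ y → refl
∑∑-listed {k} F ((a , b) ∷ L) (ab∉L ∷ uniq) = begin
  ∑ (λ x → ∑ (λ y → mask (((x == a) ∧ (y == b)) ∨ listed L x y) (F x y)))
    ≡⟨ sum-cong-≗ (λ x → sum-cong-≗ λ y → split x y) ⟩
  ∑ (λ x → ∑ (λ y → mask (x == a) (mask (y == b) (F x y)) + mask (listed L x y) (F x y)))
    ≡⟨ ∑∑-+ (λ x y → mask (x == a) (mask (y == b) (F x y))) (λ x y → mask (listed L x y) (F x y)) ⟩
  ∑ (λ x → ∑ (λ y → mask (x == a) (mask (y == b) (F x y)))) + ∑ (λ x → ∑ (λ y → mask (listed L x y) (F x y)))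
    ≡⟨ cong₂ _+_ at-ab (∑∑-listed F L uniq) ⟩
  F a b + sumOver F L ∎
  where
  open ≡-Reasoning
  at-ab : ∑ (λ x → ∑ (λ y → mask (x == a) (mask (y == b) (F x y)))) ≡ F a b
  at-ab = trans (sum-cong-≗ λ x → trans (∑-mask-out (x == a) (λ y → mask (y == b) (F x y))) (cong (mask (x == a)) (∑-at b (F x))))
                (∑-at a (λ x → F x b))
  split : ∀ x y → mask (((x == a) ∧ (y == b)) ∨ listed L x y) (F x y)
                  ≡ mask (x == a) (mask (y == b) (F x y)) + mask (listed L x y) (F x y)
  split x y with x Fin.≟ a | y Fin.≟ b | listed L x y in later
  ... | yes refl | yes refl | true  = contradiction (listed⇒∈ L x y later) λ x,y∈L → lookup ab∉L x,y∈L refl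
  ... | yes refl | yes refl | false = sym (+-identityʳ _)
  ... | yes _    | no  _    | _     = refl
  ... | no  _    | _        | _     = refl

edge-sources : ∀ {k} (ts : List (Fin k × Fin k × Fin k)) → List.map proj₁ (concatMap' triEdges ts) ≡ concatMap' triVerts ts
edge-sources []                = refl
edge-sources ((a , b , c) ∷ ts) = cong (λ l → a ∷ b ∷ c ∷ l) (edge-sources ts)

triangle-edges : ∀ {k} (ts : List (Fin k × Fin k × Fin k)) → sumOver (λ _ _ → 1) (concatMap' triEdges ts) ≡ 3 * List.length ts
triangle-edges []       = refl
triangle-edges (t ∷ ts) = trans (cong (3 +_) (triangle-edges ts)) (sym (*-suc 3 (List.length ts)))

triangle-cut : ∀ {k} (X : Fin k → Bool) (ts : List (Fin k × Fin k × Fin k)) →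
               sumOver (λ x y → b2n (X x ∧ not (X y))) (concatMap' triEdges ts) ≤ List.length ts
triangle-cut X []                = z≤n
triangle-cut X ((a , b , c) ∷ ts) = ≤-trans (one-edge (X a) (X b) (X c) _) (s≤s (triangle-cut X ts))
  where
  one-edge : ∀ p q r s → b2n (p ∧ not q) + (b2n (q ∧ not r) + (b2n (r ∧ not p) + s)) ≤ suc s
  one-edge true  true  true  s = n≤1+n s
  one-edge true  true  false s = ≤-refl
  one-edge true  false true  s = ≤-refl
  one-edge true  false false s = ≤-refl
  one-edge false true  true  s = ≤-refl
  one-edge false true  false s = ≤-refl
  one-edge false false true  s = ≤-refl
  one-edge false false false s = n≤1+n s

-- Both edges and cuts are sums over the listed triangle edges.
small-cuts : ∀ D → UnionOfDisjointTriangles D → ∀ X → 3 * cutSize D X ≤ edges D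
small-cuts D (ts , unique-vertices , E⇔) X = begin
  3 * cutSize D X                                                  ≡⟨ cong (3 *_) cut≡ ⟩
  3 * sumOver (λ x y → b2n (X x ∧ not (X y))) L                    ≤⟨ *-monoʳ-≤ 3 (triangle-cut X ts) ⟩
  3 * List.length ts                                               ≡⟨ edges≡sum ⟨
  edges D                                                          ∎
  where
  open ≤-Reasoning
  L : List (Fin (n D) × Fin (n D))
  L = concatMap' triEdges ts
  unique : Unique L
  unique = Unique.map⁻ (subst Unique (sym (edge-sources ts)) unique-vertices)
  E≡listed : ∀ x y → E D x y ≡ listed L x y
  E≡listed x y with E D x y in Exy | listed L x y in Lxy
  ... | true  | true  = refl
  ... | false | false = refl
  ... | true  | false = contradiction (∈⇒listed L x y (Equivalence.to (E⇔ x y) Exy)) (λ e → true≢false e Lxy)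
  ... | false | true  = contradiction (Equivalence.from (E⇔ x y) (listed⇒∈ L x y Lxy)) (λ e → true≢false e Exy)
  as-mask : ∀ b c → b2n (c ∧ b) ≡ mask b (b2n c)
  as-mask true  c = cong b2n (∧-identityʳ c)
  as-mask false c = cong b2n (∧-zeroʳ c)
  edges≡sum : edges D ≡ 3 * List.length ts
  edges≡sum = trans (edges≡ D) (trans (sum-cong-≗ λ x → sum-cong-≗ λ y → trans (as-mask (E D x y) true) (cong (λ b → mask b 1) (E≡listed x y)))
                      (trans (∑∑-listed (λ _ _ → 1) L unique) (triangle-edges ts)))
  cut≡ : cutSize D X ≡ sumOver (λ x y → b2n (X x ∧ not (X y))) L
  cut≡ = trans (cutSize≡ D X) (trans (sum-cong-≗ λ x → sum-cong-≗ λ y →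
                 trans (cong b2n (sym (∧-assoc (X x) (not (X y)) (E D x y))))
                       (trans (as-mask (E D x y) (X x ∧ not (X y))) (cong (λ b → mask b (b2n (X x ∧ not (X y)))) (E≡listed x y))))
               (∑∑-listed (λ x y → b2n (X x ∧ not (X y))) L unique))

-- When no cut exceeds m/3, neither construction above applies.  Then no vertex
-- has surplus; as Σ d⁺ = Σ d⁻ this forces d⁺ v = d⁻ v ≤ 1 everywhere, every
-- edge lies on a triangle, and D is a union of vertex-disjoint triangles.
module Extremal (D : Digraph) (D11 : InD₁₁ D) (no-larger : ¬ (∃[ X ] (edges D < 3 * cutSize D X))) where

  -- Otherwise EdgeOffTriangle, resp. HeavyVertex, would give a larger cut.
  light-on-triangle : ∀ u w → E D u w ≡ true → d⁻ D u ≤ 1 → d⁺ D w ≤ 1 → OnTriangle D u w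
  light-on-triangle u w u→w in-u out-w with any? (λ x → (E D w x ≟ᵇ true) ×-dec (E D x u ≟ᵇ true))
  ... | yes on  = on
  ... | no  off = contradiction (EdgeOffTriangle.larger-cut D D11 u w u→w in-u out-w off) no-larger

  few-good : ∀ v → count (good D v) ≤ d⁻ D v
  few-good v with count (good D v) ≤? d⁻ D v
  ... | yes few   = few
  ... | no  many  = contradiction (HeavyVertex.larger-cut D D11 v (≰⇒> many)) no-larger

  open NoSurplus D D11 light-on-triangle few-good using (no-surplus)

  -- d⁺ ≤ d⁻ everywhere, with equal totals.
  balanced : ∀ v → d⁺ D v ≡ d⁻ D v
  balanced = ∑-rigid out≤in (≤-reflexive (sym (∑out≡∑in D)))
    where
    out≤in : ∀ v → d⁺ D v ≤ d⁻ D v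
    out≤in v = ≤-pred (≰⇒> (does-false (_ ≤? _) (no-surplus v)))

  in≤1 : ∀ v → d⁻ D v ≤ 1
  in≤1 v with D11 v
  ... | inj₁ in≤1′  = in≤1′
  ... | inj₂ out≤1′ = subst (_≤ 1) (balanced v) out≤1′

  out≤1 : ∀ v → d⁺ D v ≤ 1
  out≤1 v = subst (_≤ 1) (sym (balanced v)) (in≤1 v)

  open TriangleDecomposition D out≤1 (λ u w u→w → light-on-triangle u w u→w (in≤1 u) (out≤1 w))
    using (decomposition) public

corollary3 : (D : Digraph) → InD 1 1 D →
    (∃[ X ] (edges D ≤ 3 * cutSize D X))
    × ((¬ (∃[ X ] (edges D < 3 * cutSize D X))) ⇔ UnionOfDisjointTriangles D)
corollary3 D inD = large-cut D D11
                 , mk⇔ (Extremal.decomposition D D11)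
                       (λ union (X , larger) → <⇒≱ larger (small-cuts D union X))
  where
  D11 : InD₁₁ D
  D11 = InD⇒InD₁₁ D inD
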